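{- Let $\mathbf{S}\subseteq\mathbf{C}$ be the subspecies with $\mathbf{S}_N=\{0\}\cup\{(\mathbf{p},\mathrm{Int}(\mathbf{p})):(\mathbf{p},\mathrm{Int}(\mathbf{p}))\text{ a coloring problem on }N\}$ and $\mathbf{I}\subseteq\mathbf{C}$ the subspecies with $\mathbf{I}_N=\{0\}\cup\{(\mathbf{p},I)\in\mathbf{C}_N: I\neq\mathrm{Int}(\mathbf{p})\}$. Then $(\mathbf{C},\mathbf{S},\mathbf{I})$ is a combinatorial Hopf monoid; that is, the species $\mathbf{C}$ of coloring problems is a combinatorial Hopf monoid whose stable structures are the coloring problems of the form $(\mathbf{p},\mathrm{Int}(\mathbf{p}))$.
   Context: A coloring problem on a finite set $N$ is a pair $(\mathbf{p},I)$ where $\mathbf{p}$ is a family of subsets of $N$ with $\emptyset,N\in\mathbf{p}$, ordered by inclusion, and $I$ is an order ideal of the poset $\mathrm{Int}(\mathbf{p})$ of intervals $[S,T]$ ($S\subseteq T$ in $\mathbf{p}$, ordered by inclusion) containing $[S,S]$ for all $S\in\mathbf{p}$. $\mathbf{C}_N=\{0\}\sqcup\{\text{coloring problems on }N\}$ (base point $0$), relabeled along bijections $\sigma$ by $(\mathbf{p},I)\mapsto(\{\sigma(S)\},\{[\sigma(S),\sigma(T)]\})$. Product (for disjoint $M,N$): $(\mathbf{p},I)\cdot(\mathbf{q},J)=(\{X\cup Y:X\in\mathbf{p},Y\in\mathbf{q}\},\{[X\cup Y,X'\cup Y']:[X,X']\in I,[Y,Y']\in J\})$, $0$ absorbing,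 unit $1=(\{\emptyset\},\{[\emptyset,\emptyset]\})\in\mathbf{C}_\emptyset$. Restriction/contraction for $S\subseteq N$: both $0$ if $S\notin\mathbf{p}$; otherwise $(\mathbf{p},I)|_S=(\{T\in\mathbf{p}:T\subseteq S\},\{[X,Y]\in I:Y\subseteq S\})$ and $(\mathbf{p},I)/S=(\{X\subseteq N\setminus S:X\cup S\in\mathbf{p}\},\{[X,Y]:X\subseteq Y\subseteq N\setminus S,[X\cup S,Y\cup S]\in I\})$; $0|_S=0/S=0$. Definitions (for a pointed set species $\mathbf{F}$ with $\mathbf{F}_\emptyset=\{0,1\}$): a monoid has products natural under relabeling, associative, unital, and absorbing ($0$ times anything is $0$). A comonoid has restrictions $\mathbf{x}|_S\in\mathbf{F}_S$ and contractions $\mathbf{x}/S\in\mathbf{F}_{N\setminus S}$, natural under relabeling, with coassociativity (for $R\subseteq S$: $\mathbf{x}|_S/R=(\mathbf{x}/R)|_{S\setminus R}$, and if this is nonzero then $(\mathbf{x}|_S)|_R=\mathbf{x}|_R$ and $\mathbf{x}/S=(\mathbf{x}/R)/(S\setminus R)$), counitality ($\mathbf{x}|_N=\mathbf{x}=\mathbf{x}/\emptyset$), zero conditions ($\mathbf{x}|_S=0$ iff $\mathbf{x}/S=0$; $0|_S=0/S=0$). It is a combinatorial comonoid if for $S\subseteq T\subseteq N$ with $\mathbf{x}|_S\neq0\neq\mathbf{x}|_T$ we have $\mathbf{x}|_T/S\neq0$. A bimonoid is both, with $(\mathbf{x}\cdot\mathbf{y})|_{S'}=\mathbf{x}|_{S\cap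 S'}\cdot\mathbf{y}|_{T\cap S'}$ and $(\mathbf{x}\cdot\mathbf{y})/S'=\mathbf{x}/(S\cap S')\cdot\mathbf{y}/(T\cap S')$ for $\mathbf{x}\in\mathbf{F}_S,\mathbf{y}\in\mathbf{F}_T$, $S'\subseteq S\sqcup T$, and $1\neq0$. A subspecies is a family $\mathbf{G}_N\subseteq\mathbf{F}_N$ (containing $0$) stable under relabeling; a Hopf submonoid is a subspecies closed under products, restrictions and contractions; an ideal is a subspecies $\mathbf{G}$ with $\mathbf{x}\cdot\mathbf{y},\mathbf{y}\cdot\mathbf{x}\in\mathbf{G}$ whenever $\mathbf{y}\in\mathbf{G}$ and $\mathbf{x}\in\mathbf{F}$. A combinatorial Hopf monoid is a triple $(\mathbf{H},\mathbf{S},\mathbf{I})$ where $\mathbf{H}$ is a bimonoid and a combinatorial comonoid, $\mathbf{S}$ is a Hopf submonoid, $\mathbf{I}$ is an ideal, and for every $N$, $\mathbf{H}_N=\mathbf{S}_N\cup\mathbf{I}_N$ with $\mathbf{S}_N\cap\mathbf{I}_N=\{0\}$; nonzero elements of $\mathbf{S}$ are called stable. -}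

module Defs where

-- Conventions:
--  * Labels are drawn from Fin k (k arbitrary); a finite set N is a
--    Subset k (= Vec Bool k, canonical, decidable equality).
--  * Bijections are represented by permutations of Fin k (every bijection
--    between subsets of Fin k extends to one); relabelling along pi sends
--    F_N to F_(pi[N]).
--  * A pointed set species is given by one carrier type E together with a
--    predicate  In N x  ("x is an element of F_N"), a base point 0 and an
--    equality relation _≈_ (extensional equality of the encoded data).
--  * Since well-definedness of the operations on C is part of what is
--    being claimed here, closure of F_N under the operations is stated
--    explicitly as part of the axioms.

open import Data.Nat using (ℕ; zero; suc)
open import Data.Bool using (Bool; true; false; _∧_; _∨_; if_then_else_)
open import Data.Fin using (Fin)
open import Data.Fin.Subset using (Subset; _⊆_; _∪_; _∩_; _─_; ⊥)
open import Data.Fin.Subset.Properties using (_⊆?_)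
open import Data.Fin.Permutation using (Permutation′; _⟨$⟩ʳ_; _⟨$⟩ˡ_; _∘ₚ_)
import Data.Fin.Permutation as Perm
open import Data.Vec using (Vec; []; _∷_; tabulate; lookup)
open import Data.Vec.Properties using (≡-dec)
import Data.Bool.Properties as BoolP
open import Data.Product using (_×_; Σ; _,_)
open import Data.Sum using (_⊎_)
open import Data.Unit using (⊤)
import Data.Empty as Empty
open import Relation.Nullary using (¬_)
open import Relation.Nullary.Decidable using (⌊_⌋)
open import Relation.Binary.PropositionalEquality using (_≡_)
open import Function.Bundles using (_⇔_)

img : ∀ {k} → Permutation′ k → Subset k → Subset k
img π N = tabulate (λ j → lookup N (π ⟨$⟩ˡ j))

preimg : ∀ {k} → Permutation′ k → Subset k → Subset k
preimg π X = tabulate (λ i → lookup X (π ⟨$⟩ʳ i))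

Disjoint : ∀ {k} → Subset k → Subset k → Set
Disjoint M N = M ∩ N ≡ ⊥

_=ˢ_ : ∀ {k} → Subset k → Subset k → Bool
X =ˢ Y = ⌊ ≡-dec BoolP._≟_ X Y ⌋

_⊆ᵇ_ : ∀ {k} → Subset k → Subset k → Bool
X ⊆ᵇ Y = ⌊ X ⊆? Y ⌋

anyS : ∀ {k} → (Subset k → Bool) → Bool
anyS {zero}  f = f []
anyS {suc k} f = anyS (λ v → f (false ∷ v)) ∨ anyS (λ v → f (true ∷ v))

record SpeciesOps (k : ℕ) : Set₁ where
  field
    E       : Set
    In      : Subset k → E → Set
    𝟘 𝟙     : E
    _≈_     : E → E → Set
    relabel : Permutation′ k → E → E
    _·_     : E → E → E                    -- product  F_M × F_N → F_(M ⊔ N)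
    restr   : Subset k → Subset k → E → E  -- restr N S x = x|_S   (x ∈ F_N)
    contr   : Subset k → Subset k → E → E  -- contr N S x = x / S  (x ∈ F_N)

module _ {k : ℕ} (F : SpeciesOps k) where
  open SpeciesOps F

  _≉_ : E → E → Set
  x ≉ y = ¬ (x ≈ y)

  record IsPointedSpecies : Set where
    field
      In-𝟘        : ∀ N → In N 𝟘
      In-𝟙        : In ⊥ 𝟙
      In-∅        : ∀ x → In ⊥ x → (x ≈ 𝟘) ⊎ (x ≈ 𝟙)
      relabel-In  : ∀ π N x → In N x → In (img π N) (relabel π x)
      relabel-𝟘   : ∀ π → relabel π 𝟘 ≈ 𝟘
      relabel-id  : ∀ N x → In N x → relabel Perm.id x ≈ x
      relabel-∘   : ∀ π ρ N x → In N x → relabel (π ∘ₚ ρ) x ≈ relabel ρ (relabel π x)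

  record IsMonoid : Set where
    field
      ·-In      : ∀ M N x y → Disjoint M N → In M x → In N y → In (M ∪ N) (x · y)
      ·-natural : ∀ π M N x y → Disjoint M N → In M x → In N y →
                  relabel π (x · y) ≈ (relabel π x · relabel π y)
      ·-assoc   : ∀ L M N x y z → Disjoint L M → Disjoint L N → Disjoint M N →
                  In L x → In M y → In N z → ((x · y) · z) ≈ (x · (y · z))
      ·-unitˡ   : ∀ N x → In N x → (𝟙 · x) ≈ x
      ·-unitʳ   : ∀ N x → In N x → (x · 𝟙) ≈ x
      ·-𝟘ˡ      : ∀ N x → In N x → (𝟘 · x) ≈ 𝟘
      ·-𝟘ʳ      : ∀ N x → In N x → (x · 𝟘) ≈ 𝟘

  record IsComonoid : Set where
    field
      restr-In      : ∀ N S x → S ⊆ N → In N x → In S (restr N S x)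
      contr-In      : ∀ N S x → S ⊆ N → In N x → In (N ─ S) (contr N S x)
      restr-natural : ∀ π N S x → S ⊆ N → In N x →
                      relabel π (restr N S x) ≈ restr (img π N) (img π S) (relabel π x)
      contr-natural : ∀ π N S x → S ⊆ N → In N x →
                      relabel π (contr N S x) ≈ contr (img π N) (img π S) (relabel π x)
      coassoc-mixed : ∀ N S R x → R ⊆ S → S ⊆ N → In N x →
                      contr S R (restr N S x) ≈ restr (N ─ R) (S ─ R) (contr N R x)
      coassoc-restr : ∀ N S R x → R ⊆ S → S ⊆ N → In N x →
                      contr S R (restr N S x) ≉ 𝟘 →
                      restr S R (restr N S x) ≈ restr N R x
      coassoc-contr : ∀ N S R x → R ⊆ S → S ⊆ N → In N x →
                      contr S R (restr N S x) ≉ 𝟘 →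
                      contr N S x ≈ contr (N ─ R) (S ─ R) (contr N R x)
      counit-restr  : ∀ N x → In N x → restr N N x ≈ x
      counit-contr  : ∀ N x → In N x → contr N ⊥ x ≈ x
      zero-iff      : ∀ N S x → S ⊆ N → In N x → (restr N S x ≈ 𝟘) ⇔ (contr N S x ≈ 𝟘)
      restr-𝟘       : ∀ N S → S ⊆ N → restr N S 𝟘 ≈ 𝟘
      contr-𝟘       : ∀ N S → S ⊆ N → contr N S 𝟘 ≈ 𝟘

  IsCombinatorialComonoid : Set
  IsCombinatorialComonoid =
    ∀ N S T x → S ⊆ T → T ⊆ N → In N x →
    restr N S x ≉ 𝟘 → restr N T x ≉ 𝟘 → contr T S (restr N T x) ≉ 𝟘

  record IsBimonoid : Set where
    field
      isPointedSpecies : IsPointedSpecies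
      isMonoid         : IsMonoid
      isComonoid       : IsComonoid
      restr-· : ∀ S T S′ x y → Disjoint S T → In S x → In T y → S′ ⊆ (S ∪ T) →
                restr (S ∪ T) S′ (x · y) ≈ (restr S (S ∩ S′) x · restr T (T ∩ S′) y)
      contr-· : ∀ S T S′ x y → Disjoint S T → In S x → In T y → S′ ⊆ (S ∪ T) →
                contr (S ∪ T) S′ (x · y) ≈ (contr S (S ∩ S′) x · contr T (T ∩ S′) y)
      𝟙≉𝟘     : 𝟙 ≉ 𝟘

  -- a subspecies G (G_N = {x ∈ F_N : G x}) contains 0 and is stable under relabelling
  record IsSubspecies (G : E → Set) : Set where
    field
      G-𝟘       : G 𝟘
      G-relabel : ∀ π N x → In N x → G x → G (relabel π x)

  record IsHopfSubmonoid (G : E → Set) : Set where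
    field
      isSubspecies : IsSubspecies G
      G-·          : ∀ M N x y → Disjoint M N → In M x → In N y → G x → G y → G (x · y)
      G-restr      : ∀ N S x → S ⊆ N → In N x → G x → G (restr N S x)
      G-contr      : ∀ N S x → S ⊆ N → In N x → G x → G (contr N S x)

  record IsIdeal (G : E → Set) : Set where
    field
      isSubspecies : IsSubspecies G
      G-ideal      : ∀ M N x y → Disjoint M N → In M x → In N y → G y →
                     G (x · y) × G (y · x)

  record IsCombinatorialHopfMonoid (𝐒 𝐈 : E → Set) : Set where
    field
      isBimonoid              : IsBimonoid
      isCombinatorialComonoid : IsCombinatorialComonoid
      𝐒-hopfSubmonoid         : IsHopfSubmonoid 𝐒
      𝐈-ideal                 : IsIdeal 𝐈
      cover                   : ∀ N x → In N x → 𝐒 x ⊎ 𝐈 x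
      disjoint                : ∀ N x → In N x → 𝐒 x → 𝐈 x → x ≈ 𝟘

module Coloring (k : ℕ) where

  -- Raw data: a family p of subsets (characteristic function) and a set I
  -- of intervals [X,Y] (characteristic function), or the base point 0.
  data Col : Set where
    𝟘  : Col
    cp : (Subset k → Bool) → (Subset k → Subset k → Bool) → Col

  record IsColoringProblem (N : Subset k) (p : Subset k → Bool)
                           (I : Subset k → Subset k → Bool) : Set where
    field
      p⊆N   : ∀ X → p X ≡ true → X ⊆ N
      ∅∈p   : p ⊥ ≡ true
      N∈p   : p N ≡ true
      I-int : ∀ X Y → I X Y ≡ true → (p X ≡ true) × (p Y ≡ true) × (X ⊆ Y)
      -- I is an order ideal of Int(p) ([X',Y'] ≤ [X,Y] iff X ⊆ X' and Y' ⊆ Y)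
      I-ideal : ∀ X Y X′ Y′ → I X Y ≡ true → p X′ ≡ true → p Y′ ≡ true →
                X ⊆ X′ → X′ ⊆ Y′ → Y′ ⊆ Y → I X′ Y′ ≡ true
      I-diag : ∀ X → p X ≡ true → I X X ≡ true

  InC : Subset k → Col → Set
  InC N 𝟘        = ⊤
  InC N (cp p I) = IsColoringProblem N p I

  _≈C_ : Col → Col → Set
  𝟘 ≈C 𝟘           = ⊤
  𝟘 ≈C cp _ _      = Empty.⊥
  cp _ _ ≈C 𝟘      = Empty.⊥
  cp p I ≈C cp q J = (∀ X → p X ≡ q X) × (∀ X Y → I X Y ≡ J X Y)

  𝟙C : Col
  𝟙C = cp (λ X → X =ˢ ⊥) (λ X Y → (X =ˢ ⊥) ∧ (Y =ˢ ⊥))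

  -- relabelling: p ↦ {σ(S) : S ∈ p},  I ↦ {[σ(S),σ(T)] : [S,T] ∈ I}
  relabelC : Permutation′ k → Col → Col
  relabelC π 𝟘        = 𝟘
  relabelC π (cp p I) = cp (λ X → p (preimg π X)) (λ X Y → I (preimg π X) (preimg π Y))

  _·C_ : Col → Col → Col
  𝟘 ·C _ = 𝟘
  cp _ _ ·C 𝟘 = 𝟘
  cp p I ·C cp q J =
    cp (λ Z → anyS λ X → anyS λ Y → p X ∧ q Y ∧ (Z =ˢ (X ∪ Y)))
       (λ Z Z′ → anyS λ X → anyS λ X′ → anyS λ Y → anyS λ Y′ →
                   I X X′ ∧ J Y Y′ ∧ (Z =ˢ (X ∪ Y)) ∧ (Z′ =ˢ (X′ ∪ Y′)))

  restrC : Subset k → Subset k → Col → Col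
  restrC N S 𝟘 = 𝟘
  restrC N S (cp p I) =
    if p S then cp (λ T → p T ∧ (T ⊆ᵇ S)) (λ X Y → I X Y ∧ (Y ⊆ᵇ S)) else 𝟘

  contrC : Subset k → Subset k → Col → Col
  contrC N S 𝟘 = 𝟘
  contrC N S (cp p I) =
    if p S
    then cp (λ X → (X ⊆ᵇ (N ─ S)) ∧ p (X ∪ S))
            (λ X Y → (X ⊆ᵇ Y) ∧ (Y ⊆ᵇ (N ─ S)) ∧ I (X ∪ S) (Y ∪ S))
    else 𝟘

  𝐂 : SpeciesOps k
  𝐂 = record
    { E = Col ; In = InC ; 𝟘 = 𝟘 ; 𝟙 = 𝟙C ; _≈_ = _≈C_ ; relabel = relabelC
    ; _·_ = _·C_ ; restr = restrC ; contr = contrC }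

  Int : (Subset k → Bool) → Subset k → Subset k → Bool
  Int p X Y = p X ∧ p Y ∧ (X ⊆ᵇ Y)

  IsFull : (Subset k → Bool) → (Subset k → Subset k → Bool) → Set
  IsFull p I = ∀ X Y → I X Y ≡ Int p X Y

  isStable : Col → Set
  isStable 𝟘        = ⊤
  isStable (cp p I) = IsFull p I

  isUnstable : Col → Set
  isUnstable 𝟘        = ⊤
  isUnstable (cp p I) = ¬ IsFull p I

module Submission where

-- In a product of
-- coloring problems on disjoint sets M and N every member Z of the family splits uniquely
-- as (M ∩ Z) ∪ (N ∩ Z), so inclusions between members of a product hold componentwise;
-- this gives the order-ideal property, associativity, and (splitting S′ ⊆ M ∪ N in the same
-- way) the compatibility of products with restriction and contraction. For R ⊆ S the
-- composites of restrictions and contractions are nonzero exactly when R and S lie in p,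
-- and then they agree as data; this gives coassociativity and the combinatorial property.
-- A problem is stable iff every comparable pair of p is an interval of I, which all
-- operations preserve; conversely [Y, Y′] = [∅, ∅] · [Y, Y′], so a product with a stable
-- result has stable factors, which makes the unstable problems an ideal.

open import Defs
open import Data.Nat using (ℕ; zero; suc)
open import Data.Bool using (Bool; true; false; _∧_; _∨_; not)
import Data.Bool.Properties as Bool
open import Data.Fin using (Fin; zero; suc)
open import Data.Fin.Subset using (Subset; _⊆_; _∪_; _∩_; _─_; ⊥)
open import Data.Fin.Subset.Properties
  using ( _⊆?_; anySubset?; ⊆-refl; ⊆-trans; ⊆-antisym; ⊆-reflexive; ⊥⊆; p⊆p∪q; q⊆p∪q
        ; p∩q⊆p; p∩q⊆q; p─q⊆p; x∈p∩q⁺; ∩-comm; ∩-distribˡ-∪; ∪-identityˡ; ∪-identityʳ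
        ; ∪-assoc; p─⊥≡p )
open import Data.Fin.Permutation using (Permutation′; _⟨$⟩ʳ_; _⟨$⟩ˡ_; _∘ₚ_; inverseˡ)
import Data.Fin.Permutation as Perm
open import Data.Vec using (Vec; []; _∷_; lookup; map)
open import Data.Vec.Properties
  using ( ≡-dec; lookup-zipWith; lookup-replicate; lookup-map; lookup∘tabulate; tabulate∘lookup
        ; tabulate-cong; []=⇒lookup; lookup⇒[]= )
open import Data.List using (List; []; _∷_)
open import Data.Product using (_×_; ∃; _,_; proj₁; proj₂)
open import Data.Sum using (_⊎_; inj₁; inj₂)
import Data.Sum as Sum
open import Data.Unit using (tt) renaming (⊤ to Unit)
open import Function using (id)
open import Function.Bundles using (_⇔_; mk⇔)
open import Relation.Nullary using (¬_; Dec; yes; no; contradiction)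
open import Relation.Nullary.Decidable using (⌊_⌋; False; toWitnessFalse; ¬?; decidable-stable)
open import Relation.Binary.PropositionalEquality
  using (_≡_; refl; sym; trans; cong; cong₂; subst; subst₂; module ≡-Reasoning)

≡true-ext : ∀ {a b} → (a ≡ true → b ≡ true) → (b ≡ true → a ≡ true) → a ≡ b
≡true-ext {false} {false} _ _ = refl
≡true-ext {false} {true}  _ g = g refl
≡true-ext {true}  {false} f _ = sym (f refl)
≡true-ext {true}  {true}  _ _ = refl

∧-≡true⁺ : ∀ {a b} → a ≡ true → b ≡ true → a ∧ b ≡ true
∧-≡true⁺ refl refl = refl

∧-≡true⁻ : ∀ a {b} → a ∧ b ≡ true → a ≡ true × b ≡ true
∧-≡true⁻ true h = refl , h

∨-≡true⁺ˡ : ∀ {a b} → a ≡ true → a ∨ b ≡ true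
∨-≡true⁺ˡ refl = refl

∨-≡true⁺ʳ : ∀ a {b} → b ≡ true → a ∨ b ≡ true
∨-≡true⁺ʳ true  _ = refl
∨-≡true⁺ʳ false h = h

∨-≡true⁻ : ∀ a {b} → a ∨ b ≡ true → a ≡ true ⊎ b ≡ true
∨-≡true⁻ true  _ = inj₁ refl
∨-≡true⁻ false h = inj₂ h

∧-redundantʳ : ∀ a {b} → (a ≡ true → b ≡ true) → a ∧ b ≡ a
∧-redundantʳ false _ = refl
∧-redundantʳ true  f = f refl

∧-redundantˡ : ∀ {a} b → (b ≡ true → a ≡ true) → a ∧ b ≡ b
∧-redundantˡ false _ = Bool.∧-zeroʳ _
∧-redundantˡ true  f = cong (_∧ true) (f refl)

≡false-contra : ∀ {b c} → (b ≡ true → c ≡ true) → c ≡ false → b ≡ false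
≡false-contra {false} _ _ = refl
≡false-contra {true}  f e = trans (sym (f refl)) e

true-or-false : ∀ b → b ≡ true ⊎ b ≡ false
true-or-false true  = inj₁ refl
true-or-false false = inj₂ refl

both-true-or-one-false : ∀ b c → b ≡ true × c ≡ true ⊎ (b ≡ false ⊎ c ≡ false)
both-true-or-one-false false _     = inj₂ (inj₁ refl)
both-true-or-one-false true  false = inj₂ (inj₂ refl)
both-true-or-one-false true  true  = inj₁ (refl , refl)

⌊⌋≡true⁻ : ∀ {P : Set} (d : Dec P) → ⌊ d ⌋ ≡ true → P
⌊⌋≡true⁻ (yes p) _ = p

⌊⌋≡true⁺ : ∀ {P : Set} (d : Dec P) → P → ⌊ d ⌋ ≡ true
⌊⌋≡true⁺ (yes _) _ = refl
⌊⌋≡true⁺ (no ¬p) p = contradiction p ¬p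

module _ {k : ℕ} where

  lookup-∪ : ∀ (X Y : Subset k) i → lookup (X ∪ Y) i ≡ lookup X i ∨ lookup Y i
  lookup-∪ X Y i = lookup-zipWith _∨_ i X Y

  lookup-∩ : ∀ (X Y : Subset k) i → lookup (X ∩ Y) i ≡ lookup X i ∧ lookup Y i
  lookup-∩ X Y i = lookup-zipWith _∧_ i X Y

  lookup-⊥ : ∀ i → lookup (⊥ {k}) i ≡ false
  lookup-⊥ i = lookup-replicate i false

  ≗⇒≡ : ∀ {X Y : Subset k} → (∀ i → lookup X i ≡ lookup Y i) → X ≡ Y
  ≗⇒≡ {X} {Y} h = trans (sym (tabulate∘lookup X)) (trans (tabulate-cong h) (tabulate∘lookup Y))

  lookup⇒⊆ : ∀ {X Y : Subset k} →
             (∀ i → lookup X i ≡ true → lookup Y i ≡ true) → X ⊆ Y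
  lookup⇒⊆ {Y = Y} h {i} i∈X = lookup⇒[]= i Y (h i ([]=⇒lookup i∈X))

  ⊆⇒lookup : ∀ {X Y : Subset k} → X ⊆ Y → ∀ i → lookup X i ≡ true → lookup Y i ≡ true
  ⊆⇒lookup {X} h i e = []=⇒lookup (h (lookup⇒[]= i X e))

lookup-─ : ∀ {k} (X Y : Subset k) i → lookup (X ─ Y) i ≡ lookup X i ∧ not (lookup Y i)
lookup-─ (x ∷ X) (false ∷ Y) zero    = sym (Bool.∧-identityʳ x)
lookup-─ (x ∷ X) (true  ∷ Y) zero    = sym (Bool.∧-zeroʳ x)
lookup-─ (x ∷ X) (y     ∷ Y) (suc i) = lookup-─ X Y i

-- An inclusion holds iff it holds at every point i of Fin k; at a point it is
-- a propositional formula in the m variables, refuted by exhaustive search.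
module SubsetSolver where

  infixr 6 _∪′_
  infixr 7 _∩′_
  infixl 5 _─′_

  data Expr (m : ℕ) : Set where
    var            : Fin m → Expr m
    _∪′_ _∩′_ _─′_ : Expr m → Expr m → Expr m
    ∅′             : Expr m

  ⟦_⟧ : ∀ {k m} → Expr m → Vec (Subset k) m → Subset k
  ⟦ var j  ⟧ ρ = lookup ρ j
  ⟦ a ∪′ b ⟧ ρ = ⟦ a ⟧ ρ ∪ ⟦ b ⟧ ρ
  ⟦ a ∩′ b ⟧ ρ = ⟦ a ⟧ ρ ∩ ⟦ b ⟧ ρ
  ⟦ a ─′ b ⟧ ρ = ⟦ a ⟧ ρ ─ ⟦ b ⟧ ρ
  ⟦ ∅′     ⟧ ρ = ⊥

  eval : ∀ {m} → Expr m → Vec Bool m → Bool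
  eval (var j)  v = lookup v j
  eval (a ∪′ b) v = eval a v ∨ eval b v
  eval (a ∩′ b) v = eval a v ∧ eval b v
  eval (a ─′ b) v = eval a v ∧ not (eval b v)
  eval ∅′       v = false

  Inclusion : ℕ → Set
  Inclusion m = Expr m × Expr m

  Holds : ∀ {k m} → Vec (Subset k) m → List (Inclusion m) → Set
  Holds ρ []             = Unit
  Holds ρ ((a , b) ∷ hs) = (⟦ a ⟧ ρ ⊆ ⟦ b ⟧ ρ) × Holds ρ hs

  holdsᵇ : ∀ {m} → List (Inclusion m) → Vec Bool m → Bool
  holdsᵇ []             v = true
  holdsᵇ ((a , b) ∷ hs) v = (not (eval a v) ∨ eval b v) ∧ holdsᵇ hs v

  Counterexample : ∀ {m} → List (Inclusion m) → Inclusion m → Vec Bool m → Set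
  Counterexample hs (a , b) v = holdsᵇ hs v ∧ eval a v ∧ not (eval b v) ≡ true

  v₀ : ∀ {m} → Expr (suc m)
  v₀ = var zero
  v₁ : ∀ {m} → Expr (suc (suc m))
  v₁ = var (suc zero)
  v₂ : ∀ {m} → Expr (suc (suc (suc m)))
  v₂ = var (suc (suc zero))
  v₃ : ∀ {m} → Expr (suc (suc (suc (suc m))))
  v₃ = var (suc (suc (suc zero)))
  v₄ : ∀ {m} → Expr (suc (suc (suc (suc (suc m)))))
  v₄ = var (suc (suc (suc (suc zero))))
  v₅ : ∀ {m} → Expr (suc (suc (suc (suc (suc (suc m))))))
  v₅ = var (suc (suc (suc (suc (suc zero)))))

  counterexample? : ∀ {m} hs (goal : Inclusion m) → Dec (∃ (Counterexample hs goal))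
  counterexample? hs goal = anySubset? (λ v → _ Bool.≟ true)

  module _ {k m : ℕ} (ρ : Vec (Subset k) m) where

    column : Fin k → Vec Bool m
    column i = map (λ X → lookup X i) ρ

    lookup-⟦⟧ : ∀ (e : Expr m) i → lookup (⟦ e ⟧ ρ) i ≡ eval e (column i)
    lookup-⟦⟧ (var j)  i = sym (lookup-map j (λ X → lookup X i) ρ)
    lookup-⟦⟧ (a ∪′ b) i =
      trans (lookup-∪ (⟦ a ⟧ ρ) (⟦ b ⟧ ρ) i) (cong₂ _∨_ (lookup-⟦⟧ a i) (lookup-⟦⟧ b i))
    lookup-⟦⟧ (a ∩′ b) i =
      trans (lookup-∩ (⟦ a ⟧ ρ) (⟦ b ⟧ ρ) i) (cong₂ _∧_ (lookup-⟦⟧ a i) (lookup-⟦⟧ b i))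
    lookup-⟦⟧ (a ─′ b) i = trans (lookup-─ (⟦ a ⟧ ρ) (⟦ b ⟧ ρ) i)
                                 (cong₂ (λ x y → x ∧ not y) (lookup-⟦⟧ a i) (lookup-⟦⟧ b i))
    lookup-⟦⟧ ∅′       i = lookup-⊥ i

    private
      eval-⊆ : ∀ {a b : Expr m} → ⟦ a ⟧ ρ ⊆ ⟦ b ⟧ ρ → ∀ i →
               eval a (column i) ≡ true → eval b (column i) ≡ true
      eval-⊆ {a} {b} h i e =
        trans (sym (lookup-⟦⟧ b i)) (⊆⇒lookup h i (trans (lookup-⟦⟧ a i) e))

      holdsᵇ-column : ∀ hs → Holds ρ hs → ∀ i → holdsᵇ hs (column i) ≡ true
      holdsᵇ-column []             _         i = refl
      holdsᵇ-column ((a , b) ∷ hs) (h , hs′) i with eval a (column i) in ea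
      ... | false = holdsᵇ-column hs hs′ i
      ... | true  = ∧-≡true⁺ (eval-⊆ {a} {b} h i ea) (holdsᵇ-column hs hs′ i)

    -- For concrete hs, a and b the implicit certificate normalises to ⊤ when the search
    -- finds no counterexample, so Agda fills it in.
    prove-⊆ : ∀ hs a b → {False (counterexample? hs (a , b))} →
              Holds ρ hs → ⟦ a ⟧ ρ ⊆ ⟦ b ⟧ ρ
    prove-⊆ hs a b {valid} hyps = lookup⇒⊆ λ i aᵢ →
      trans (lookup-⟦⟧ b i) (at i (trans (sym (lookup-⟦⟧ a i)) aᵢ))
      where
      at : ∀ i → eval a (column i) ≡ true → eval b (column i) ≡ true
      at i ea with true-or-false (eval b (column i))
      ... | inj₁ eb = eb
      ... | inj₂ eb = contradiction
        (column i , ∧-≡true⁺ (holdsᵇ-column hs hyps i) (∧-≡true⁺ ea (cong not eb)))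
        (toWitnessFalse valid)

    prove-≡ : ∀ hs a b → {False (counterexample? hs (a , b))} →
              {False (counterexample? hs (b , a))} → Holds ρ hs → ⟦ a ⟧ ρ ≡ ⟦ b ⟧ ρ
    prove-≡ hs a b {a⊆b} {b⊆a} hyps =
      ⊆-antisym (prove-⊆ hs a b {a⊆b} hyps) (prove-⊆ hs b a {b⊆a} hyps)

open SubsetSolver using (v₀; v₁; v₂; v₃; v₄; v₅; _∪′_; _∩′_; _─′_; ∅′; prove-⊆; prove-≡)

module _ {k : ℕ} where

  ⊆ᵇ⁻ : ∀ {X Y : Subset k} → X ⊆ᵇ Y ≡ true → X ⊆ Y
  ⊆ᵇ⁻ {X} {Y} = ⌊⌋≡true⁻ (X ⊆? Y)

  ⊆ᵇ⁺ : ∀ {X Y : Subset k} → X ⊆ Y → X ⊆ᵇ Y ≡ true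
  ⊆ᵇ⁺ {X} {Y} = ⌊⌋≡true⁺ (X ⊆? Y)

  =ˢ⁻ : ∀ {X Y : Subset k} → X =ˢ Y ≡ true → X ≡ Y
  =ˢ⁻ {X} {Y} = ⌊⌋≡true⁻ (≡-dec Bool._≟_ X Y)

  =ˢ⁺ : ∀ {X Y : Subset k} → X ≡ Y → X =ˢ Y ≡ true
  =ˢ⁺ {X} {Y} = ⌊⌋≡true⁺ (≡-dec Bool._≟_ X Y)

  ⊆-∩ : ∀ {A X Y : Subset k} → A ⊆ X → A ⊆ Y → A ⊆ X ∩ Y
  ⊆-∩ A⊆X A⊆Y x∈A = x∈p∩q⁺ (A⊆X x∈A , A⊆Y x∈A)

  ∩-monoʳ : ∀ {X Z Z′ : Subset k} → Z ⊆ Z′ → X ∩ Z ⊆ X ∩ Z′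
  ∩-monoʳ Z⊆Z′ = ⊆-∩ (p∩q⊆p _ _) (⊆-trans (p∩q⊆q _ _) Z⊆Z′)

  ∪-mono : ∀ {X Y M N : Subset k} → X ⊆ M → Y ⊆ N → X ∪ Y ⊆ M ∪ N
  ∪-mono {X} {Y} {M} {N} X⊆M Y⊆N = prove-⊆ (X ∷ Y ∷ M ∷ N ∷ []) ((v₀ , v₂) ∷ (v₁ , v₃) ∷ [])
                                            (v₀ ∪′ v₁) (v₂ ∪′ v₃) (X⊆M , Y⊆N , tt)

  ─-monoˡ : ∀ {S N : Subset k} R → S ⊆ N → S ─ R ⊆ N ─ R
  ─-monoˡ {S} {N} R S⊆N =
    prove-⊆ (S ∷ N ∷ R ∷ []) ((v₀ , v₁) ∷ []) (v₀ ─′ v₂) (v₁ ─′ v₂) (S⊆N , tt)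

  ─-∪-cancel : ∀ {S N : Subset k} → S ⊆ N → (N ─ S) ∪ S ≡ N
  ─-∪-cancel {S} {N} S⊆N =
    prove-≡ (S ∷ N ∷ []) ((v₀ , v₁) ∷ []) ((v₁ ─′ v₀) ∪′ v₀) v₁ (S⊆N , tt)

  ∪─-∪-cancel : ∀ {S R : Subset k} X → R ⊆ S → (X ∪ (S ─ R)) ∪ R ≡ X ∪ S
  ∪─-∪-cancel {S} {R} X R⊆S = trans (∪-assoc X (S ─ R) R) (cong (X ∪_) (─-∪-cancel R⊆S))

  ⊆─⇒∪⊆ : ∀ {X S R : Subset k} → R ⊆ S → X ⊆ S ─ R → X ∪ R ⊆ S
  ⊆─⇒∪⊆ {X} {S} {R} R⊆S X⊆S─R = subst (X ∪ R ⊆_) (─-∪-cancel R⊆S) (∪-mono X⊆S─R ⊆-refl)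

  ⊆∪⇒≡∩∪∩ : ∀ {Z S T : Subset k} → Z ⊆ S ∪ T → Z ≡ (S ∩ Z) ∪ (T ∩ Z)
  ⊆∪⇒≡∩∪∩ {Z} {S} {T} Z⊆S∪T = prove-≡ (S ∷ T ∷ Z ∷ []) ((v₂ , v₀ ∪′ v₁) ∷ [])
                                       v₂ ((v₀ ∩′ v₂) ∪′ (v₁ ∩′ v₂)) (Z⊆S∪T , tt)

  ∩-⊆-─ : ∀ {Z U S S′ : Subset k} → Z ⊆ U ─ S′ → S ∩ Z ⊆ S ─ (S ∩ S′)
  ∩-⊆-─ {Z} {U} {S} {S′} Z⊆U─S′ = prove-⊆ (S ∷ U ∷ S′ ∷ Z ∷ []) ((v₃ , v₁ ─′ v₂) ∷ [])
                                            (v₀ ∩′ v₃) (v₀ ─′ (v₀ ∩′ v₂)) (Z⊆U─S′ , tt)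

  ∪-⊆-─ : ∀ {A B S T S′ : Subset k} →
          A ⊆ S ─ (S ∩ S′) → B ⊆ T ─ (T ∩ S′) → A ∪ B ⊆ (S ∪ T) ─ S′
  ∪-⊆-─ {A} {B} {S} {T} {S′} A⊆ B⊆ =
    prove-⊆ (S ∷ T ∷ S′ ∷ A ∷ B ∷ []) ((v₃ , v₀ ─′ (v₀ ∩′ v₂)) ∷ (v₄ , v₁ ─′ (v₁ ∩′ v₂)) ∷ [])
            (v₃ ∪′ v₄) ((v₀ ∪′ v₁) ─′ v₂) (A⊆ , B⊆ , tt)

  ∪-∪-∩ : ∀ {S T S′ : Subset k} A B → S′ ⊆ S ∪ T →
          (A ∪ B) ∪ S′ ≡ (A ∪ (S ∩ S′)) ∪ (B ∪ (T ∩ S′))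
  ∪-∪-∩ {S} {T} {S′} A B S′⊆S∪T =
    prove-≡ (S ∷ T ∷ S′ ∷ A ∷ B ∷ []) ((v₂ , v₀ ∪′ v₁) ∷ [])
            ((v₃ ∪′ v₄) ∪′ v₂) ((v₃ ∪′ (v₀ ∩′ v₂)) ∪′ (v₄ ∪′ (v₁ ∩′ v₂))) (S′⊆S∪T , tt)

  module _ {R S N : Subset k} (R⊆S : R ⊆ S) (S⊆N : S ⊆ N) where

    ─-─-cancel : (N ─ R) ─ (S ─ R) ≡ N ─ S
    ─-─-cancel = prove-≡ (R ∷ S ∷ N ∷ []) ((v₀ , v₁) ∷ (v₁ , v₂) ∷ [])
                         ((v₂ ─′ v₀) ─′ (v₁ ─′ v₀)) (v₂ ─′ v₁) (R⊆S , S⊆N , tt)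

    ∪─-⊆ : ∀ {X} → X ⊆ N ─ S → X ∪ (S ─ R) ⊆ N ─ R
    ∪─-⊆ {X} X⊆N─S =
      prove-⊆ (R ∷ S ∷ N ∷ X ∷ []) ((v₀ , v₁) ∷ (v₁ , v₂) ∷ (v₃ , v₂ ─′ v₁) ∷ [])
              (v₃ ∪′ (v₁ ─′ v₀)) (v₂ ─′ v₀) (R⊆S , S⊆N , X⊆N─S , tt)

module _ {k : ℕ} {M N : Subset k} (M#N : Disjoint M N) where

  private
    M∩N⊆⊥ : M ∩ N ⊆ ⊥
    M∩N⊆⊥ = ⊆-reflexive M#N

  ∪-⊆-componentwise : ∀ {A B A′ B′} → A ⊆ M → B ⊆ N → A′ ⊆ M → B′ ⊆ N →
                      A ∪ B ⊆ A′ ∪ B′ → A ⊆ A′ × B ⊆ B′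
  ∪-⊆-componentwise {A} {B} {A′} {B′} A⊆M B⊆N A′⊆M B′⊆N h =
    prove-⊆ ρ hyps v₂ v₄ facts , prove-⊆ ρ hyps v₃ v₅ facts
    where
    ρ     = M ∷ N ∷ A ∷ B ∷ A′ ∷ B′ ∷ []
    hyps  = (v₀ ∩′ v₁ , ∅′) ∷ (v₂ , v₀) ∷ (v₃ , v₁) ∷ (v₄ , v₀) ∷ (v₅ , v₁) ∷
            (v₂ ∪′ v₃ , v₄ ∪′ v₅) ∷ []
    facts : SubsetSolver.Holds ρ hyps
    facts = M∩N⊆⊥ , A⊆M , B⊆N , A′⊆M , B′⊆N , h , tt

  ∪-≡-componentwise : ∀ {A B A′ B′} → A ⊆ M → B ⊆ N → A′ ⊆ M → B′ ⊆ N →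
                      A ∪ B ≡ A′ ∪ B′ → A ≡ A′ × B ≡ B′
  ∪-≡-componentwise A⊆M B⊆N A′⊆M B′⊆N e =
    let A⊆A′ , B⊆B′ = ∪-⊆-componentwise A⊆M B⊆N A′⊆M B′⊆N (⊆-reflexive e)
        A′⊆A , B′⊆B = ∪-⊆-componentwise A′⊆M B′⊆N A⊆M B⊆N (⊆-reflexive (sym e))
    in ⊆-antisym A⊆A′ A′⊆A , ⊆-antisym B⊆B′ B′⊆B

  ∩-∪-cancelˡ : ∀ {A B} → A ⊆ M → B ⊆ N → M ∩ (A ∪ B) ≡ A
  ∩-∪-cancelˡ {A} {B} A⊆M B⊆N =
    prove-≡ (M ∷ N ∷ A ∷ B ∷ []) ((v₀ ∩′ v₁ , ∅′) ∷ (v₂ , v₀) ∷ (v₃ , v₁) ∷ [])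
            (v₀ ∩′ (v₂ ∪′ v₃)) v₂ (M∩N⊆⊥ , A⊆M , B⊆N , tt)

  ∩-∪-cancelʳ : ∀ {A B} → A ⊆ M → B ⊆ N → N ∩ (A ∪ B) ≡ B
  ∩-∪-cancelʳ {A} {B} A⊆M B⊆N =
    prove-≡ (M ∷ N ∷ A ∷ B ∷ []) ((v₀ ∩′ v₁ , ∅′) ∷ (v₂ , v₀) ∷ (v₃ , v₁) ∷ [])
            (v₁ ∩′ (v₂ ∪′ v₃)) v₃ (M∩N⊆⊥ , A⊆M , B⊆N , tt)

anyS⁻ : ∀ {k} (f : Subset k → Bool) → anyS f ≡ true → ∃ λ X → f X ≡ true
anyS⁻ {zero}  f e = [] , e
anyS⁻ {suc k} f e with ∨-≡true⁻ (anyS (λ v → f (false ∷ v))) e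
... | inj₁ h = let v , fv = anyS⁻ _ h in false ∷ v , fv
... | inj₂ h = let v , fv = anyS⁻ _ h in true ∷ v , fv

anyS⁺ : ∀ {k} (f : Subset k → Bool) X → f X ≡ true → anyS f ≡ true
anyS⁺ {zero}  f []          e = e
anyS⁺ {suc k} f (false ∷ v) e = ∨-≡true⁺ˡ (anyS⁺ (λ v → f (false ∷ v)) v e)
anyS⁺ {suc k} f (true  ∷ v) e =
  ∨-≡true⁺ʳ (anyS (λ v → f (false ∷ v))) (anyS⁺ (λ v → f (true ∷ v)) v e)

allSubsets? : ∀ {k} {P : Subset k → Set} → (∀ X → Dec (P X)) → Dec (∀ X → P X)
allSubsets? P? with anySubset? (λ X → ¬? (P? X))
... | yes (X , ¬PX) = no λ ∀P → ¬PX (∀P X)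
... | no ∄¬P        = yes λ X → decidable-stable (P? X) λ ¬PX → ∄¬P (X , ¬PX)

module _ {k : ℕ} (π : Permutation′ k) where

  lookup-preimg : ∀ (X : Subset k) i → lookup (preimg π X) i ≡ lookup X (π ⟨$⟩ʳ i)
  lookup-preimg X i = lookup∘tabulate _ i

  preimg-img : ∀ X → preimg π (img π X) ≡ X
  preimg-img X = ≗⇒≡ λ i → begin
    lookup (preimg π (img π X)) i  ≡⟨ lookup-preimg (img π X) i ⟩
    lookup (img π X) (π ⟨$⟩ʳ i)    ≡⟨ lookup∘tabulate (λ j → lookup X (π ⟨$⟩ˡ j)) _ ⟩
    lookup X (π ⟨$⟩ˡ (π ⟨$⟩ʳ i))   ≡⟨ cong (lookup X) (inverseˡ π) ⟩
    lookup X i                     ∎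
    where open ≡-Reasoning

  preimg-mono : ∀ {X Y} → X ⊆ Y → preimg π X ⊆ preimg π Y
  preimg-mono {X} {Y} h = lookup⇒⊆ λ i e →
    trans (lookup-preimg Y i) (⊆⇒lookup h _ (trans (sym (lookup-preimg X i)) e))

  preimg-∪ : ∀ X Y → preimg π (X ∪ Y) ≡ preimg π X ∪ preimg π Y
  preimg-∪ X Y = ≗⇒≡ λ i → begin
    lookup (preimg π (X ∪ Y)) i                    ≡⟨ lookup-preimg (X ∪ Y) i ⟩
    lookup (X ∪ Y) (π ⟨$⟩ʳ i)                      ≡⟨ lookup-∪ X Y _ ⟩
    lookup X (π ⟨$⟩ʳ i) ∨ lookup Y (π ⟨$⟩ʳ i)      ≡⟨ cong₂ _∨_ (lookup-preimg X i) (lookup-preimg Y i) ⟨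
    lookup (preimg π X) i ∨ lookup (preimg π Y) i  ≡⟨ lookup-∪ (preimg π X) (preimg π Y) i ⟨
    lookup (preimg π X ∪ preimg π Y) i             ∎
    where open ≡-Reasoning

  preimg-─ : ∀ X Y → preimg π (X ─ Y) ≡ preimg π X ─ preimg π Y
  preimg-─ X Y = ≗⇒≡ λ i → begin
    lookup (preimg π (X ─ Y)) i                          ≡⟨ lookup-preimg (X ─ Y) i ⟩
    lookup (X ─ Y) (π ⟨$⟩ʳ i)                            ≡⟨ lookup-─ X Y _ ⟩
    lookup X (π ⟨$⟩ʳ i) ∧ not (lookup Y (π ⟨$⟩ʳ i))
      ≡⟨ cong₂ (λ a b → a ∧ not b) (lookup-preimg X i) (lookup-preimg Y i) ⟨
    lookup (preimg π X) i ∧ not (lookup (preimg π Y) i)  ≡⟨ lookup-─ (preimg π X) (preimg π Y) i ⟨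
    lookup (preimg π X ─ preimg π Y) i                   ∎
    where open ≡-Reasoning

  preimg-⊥ : preimg π ⊥ ≡ ⊥
  preimg-⊥ = ≗⇒≡ λ i →
    trans (lookup-preimg ⊥ i) (trans (lookup-⊥ (π ⟨$⟩ʳ i)) (sym (lookup-⊥ i)))

-- img π is definitionally preimg (flip π).
module _ {k : ℕ} (π : Permutation′ k) where

  img-preimg : ∀ X → img π (preimg π X) ≡ X
  img-preimg = preimg-img (Perm.flip π)

  img-mono : ∀ {X Y} → X ⊆ Y → img π X ⊆ img π Y
  img-mono = preimg-mono (Perm.flip π)

  img-∪ : ∀ X Y → img π (X ∪ Y) ≡ img π X ∪ img π Y
  img-∪ = preimg-∪ (Perm.flip π)

  img-─ : ∀ X Y → img π (X ─ Y) ≡ img π X ─ img π Y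
  img-─ = preimg-─ (Perm.flip π)

  preimg-reflects-⊆ : ∀ {X Y} → preimg π X ⊆ preimg π Y → X ⊆ Y
  preimg-reflects-⊆ {X} {Y} h = subst₂ _⊆_ (img-preimg X) (img-preimg Y) (img-mono h)

  preimg-⊆ᵇ-img : ∀ X A → (preimg π X ⊆ᵇ A) ≡ (X ⊆ᵇ img π A)
  preimg-⊆ᵇ-img X A = ≡true-ext
    (λ e → ⊆ᵇ⁺ (subst (_⊆ img π A) (img-preimg X) (img-mono (⊆ᵇ⁻ e))))
    (λ e → ⊆ᵇ⁺ (subst (preimg π X ⊆_) (preimg-img π A) (preimg-mono π (⊆ᵇ⁻ e))))

  preimg-⊆ᵇ : ∀ X Y → (preimg π X ⊆ᵇ preimg π Y) ≡ (X ⊆ᵇ Y)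
  preimg-⊆ᵇ X Y = ≡true-ext (λ e → ⊆ᵇ⁺ (preimg-reflects-⊆ (⊆ᵇ⁻ e)))
                            (λ e → ⊆ᵇ⁺ (preimg-mono π (⊆ᵇ⁻ e)))

preimg-id : ∀ {k} (X : Subset k) → preimg Perm.id X ≡ X
preimg-id X = ≗⇒≡ (lookup-preimg Perm.id X)

preimg-∘ : ∀ {k} (π ρ : Permutation′ k) X → preimg (π ∘ₚ ρ) X ≡ preimg π (preimg ρ X)
preimg-∘ π ρ X = ≗⇒≡ λ i → trans (lookup-preimg (π ∘ₚ ρ) X i)
                                 (sym (trans (lookup-preimg π (preimg ρ X) i) (lookup-preimg ρ X _)))

module ColoringProblems (k : ℕ) where
  open Coloring k
  open ≡-Reasoning

  Family : Set
  Family = Subset k → Bool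

  Intervals : Set
  Intervals = Subset k → Subset k → Bool

  restrictᶠ : Family → Subset k → Family
  restrictᶠ p S T = p T ∧ (T ⊆ᵇ S)

  restrictⁱ : Intervals → Subset k → Intervals
  restrictⁱ I S X Y = I X Y ∧ (Y ⊆ᵇ S)

  contractᶠ : Subset k → Subset k → Family → Family
  contractᶠ N S p X = (X ⊆ᵇ (N ─ S)) ∧ p (X ∪ S)

  contractⁱ : Subset k → Subset k → Intervals → Intervals
  contractⁱ N S I X Y = (X ⊆ᵇ Y) ∧ (Y ⊆ᵇ (N ─ S)) ∧ I (X ∪ S) (Y ∪ S)

  _⊗ᶠ_ : Family → Family → Family
  (p ⊗ᶠ q) Z = anyS λ X → anyS λ Y → p X ∧ q Y ∧ (Z =ˢ (X ∪ Y))

  _⊗ⁱ_ : Intervals → Intervals → Intervals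
  (I ⊗ⁱ J) Z Z′ = anyS λ X → anyS λ X′ → anyS λ Y → anyS λ Y′ →
                    I X X′ ∧ J Y Y′ ∧ (Z =ˢ (X ∪ Y)) ∧ (Z′ =ˢ (X′ ∪ Y′))

  restrC-∈ : ∀ N S p I → p S ≡ true →
             restrC N S (cp p I) ≡ cp (restrictᶠ p S) (restrictⁱ I S)
  restrC-∈ N S p I e rewrite e = refl

  restrC-∉ : ∀ N S p I → p S ≡ false → restrC N S (cp p I) ≡ 𝟘
  restrC-∉ N S p I e rewrite e = refl

  contrC-∈ : ∀ N S p I → p S ≡ true →
             contrC N S (cp p I) ≡ cp (contractᶠ N S p) (contractⁱ N S I)
  contrC-∈ N S p I e rewrite e = refl

  contrC-∉ : ∀ N S p I → p S ≡ false → contrC N S (cp p I) ≡ 𝟘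
  contrC-∉ N S p I e rewrite e = refl

  record Split (p q : Family) (Z : Subset k) : Set where
    constructor split
    field
      X Y  : Subset k
      X∈p  : p X ≡ true
      Y∈q  : q Y ≡ true
      Z≡   : Z ≡ X ∪ Y

  record IntervalSplit (I J : Intervals) (Z Z′ : Subset k) : Set where
    constructor isplit
    field
      X X′ Y Y′ : Subset k
      XX′∈I     : I X X′ ≡ true
      YY′∈J     : J Y Y′ ≡ true
      Z≡        : Z ≡ X ∪ Y
      Z′≡       : Z′ ≡ X′ ∪ Y′

  ⊗ᶠ⁻ : ∀ p q {Z} → (p ⊗ᶠ q) Z ≡ true → Split p q Z
  ⊗ᶠ⁻ p q {Z} e =
    let X , e′ = anyS⁻ _ e
        Y , e″ = anyS⁻ _ e′
        X∈p , e‴ = ∧-≡true⁻ (p X) e″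
        Y∈q , Z=X∪Y = ∧-≡true⁻ (q Y) e‴
    in split X Y X∈p Y∈q (=ˢ⁻ Z=X∪Y)

  ⊗ᶠ⁺ : ∀ p q {Z} → Split p q Z → (p ⊗ᶠ q) Z ≡ true
  ⊗ᶠ⁺ p q (split X Y X∈p Y∈q Z≡) =
    anyS⁺ _ X (anyS⁺ _ Y (∧-≡true⁺ X∈p (∧-≡true⁺ Y∈q (=ˢ⁺ Z≡))))

  ⊗ⁱ⁻ : ∀ I J {Z Z′} → (I ⊗ⁱ J) Z Z′ ≡ true → IntervalSplit I J Z Z′
  ⊗ⁱ⁻ I J {Z} {Z′} e =
    let X , e₁ = anyS⁻ _ e
        X′ , e₂ = anyS⁻ _ e₁
        Y , e₃ = anyS⁻ _ e₂
        Y′ , e₄ = anyS⁻ _ e₃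
        XX′∈I , e₅ = ∧-≡true⁻ (I X X′) e₄
        YY′∈J , e₆ = ∧-≡true⁻ (J Y Y′) e₅
        Z≡ , Z′≡ = ∧-≡true⁻ (Z =ˢ (X ∪ Y)) e₆
    in isplit X X′ Y Y′ XX′∈I YY′∈J (=ˢ⁻ Z≡) (=ˢ⁻ Z′≡)

  ⊗ⁱ⁺ : ∀ I J {Z Z′} → IntervalSplit I J Z Z′ → (I ⊗ⁱ J) Z Z′ ≡ true
  ⊗ⁱ⁺ I J (isplit X X′ Y Y′ XX′∈I YY′∈J Z≡ Z′≡) =
    anyS⁺ _ X (anyS⁺ _ X′ (anyS⁺ _ Y (anyS⁺ _ Y′
      (∧-≡true⁺ XX′∈I (∧-≡true⁺ YY′∈J (∧-≡true⁺ (=ˢ⁺ Z≡) (=ˢ⁺ Z′≡)))))))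

  ≈C-resp-≡ : ∀ {x x′ y y′} → x ≡ x′ → y ≡ y′ → x′ ≈C y′ → x ≈C y
  ≈C-resp-≡ refl refl h = h

  ∈-resp : ∀ (p : Family) {X Y} → X ≡ Y → p X ≡ true → p Y ≡ true
  ∈-resp p = subst (λ W → p W ≡ true)

  ∈ⁱ-resp : ∀ (I : Intervals) {X Y X′ Y′} → X ≡ X′ → Y ≡ Y′ → I X Y ≡ true → I X′ Y′ ≡ true
  ∈ⁱ-resp I = subst₂ (λ W V → I W V ≡ true)

  module Problem {N p I} (c : IsColoringProblem N p I) where
    open IsColoringProblem c public

    ⊆N : ∀ {X} → p X ≡ true → X ⊆ N
    ⊆N = p⊆N _

    lower∈ : ∀ {X Y} → I X Y ≡ true → p X ≡ true
    lower∈ e = proj₁ (I-int _ _ e)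

    upper∈ : ∀ {X Y} → I X Y ≡ true → p Y ≡ true
    upper∈ e = proj₁ (proj₂ (I-int _ _ e))

    lower⊆upper : ∀ {X Y} → I X Y ≡ true → X ⊆ Y
    lower⊆upper e = proj₂ (proj₂ (I-int _ _ e))

  In-𝟙 : InC ⊥ 𝟙C
  In-𝟙 = record
    { p⊆N     = λ X X≡⊥ → ⊆-reflexive (=ˢ⁻ X≡⊥)
    ; ∅∈p     = =ˢ⁺ refl
    ; N∈p     = =ˢ⁺ refl
    ; I-int   = λ X Y e → let X≡⊥ , Y≡⊥ = ∧-≡true⁻ (X =ˢ ⊥) e in
                  X≡⊥ , Y≡⊥ , ⊆-reflexive (trans (=ˢ⁻ X≡⊥) (sym (=ˢ⁻ Y≡⊥)))
    ; I-ideal = λ _ _ _ _ _ X′≡⊥ Y′≡⊥ _ _ _ → ∧-≡true⁺ X′≡⊥ Y′≡⊥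
    ; I-diag  = λ _ X≡⊥ → ∧-≡true⁺ X≡⊥ X≡⊥
    }

  In-∅ : ∀ x → InC ⊥ x → (x ≈C 𝟘) ⊎ (x ≈C 𝟙C)
  In-∅ 𝟘        _ = inj₁ tt
  In-∅ (cp p I) c = inj₂ (family , intervals)
    where
    open Problem c
    ∈⇒≡⊥ : ∀ {X} → p X ≡ true → X ≡ ⊥
    ∈⇒≡⊥ e = ⊆-antisym (⊆N e) ⊥⊆
    family : ∀ X → p X ≡ (X =ˢ ⊥)
    family X = ≡true-ext (λ e → =ˢ⁺ (∈⇒≡⊥ e)) (λ e → ∈-resp p (sym (=ˢ⁻ e)) ∅∈p)
    intervals : ∀ X Y → I X Y ≡ ((X =ˢ ⊥) ∧ (Y =ˢ ⊥))
    intervals X Y = ≡true-ext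
      (λ e → ∧-≡true⁺ (=ˢ⁺ (∈⇒≡⊥ (lower∈ e))) (=ˢ⁺ (∈⇒≡⊥ (upper∈ e))))
      (λ e → let X≡⊥ , Y≡⊥ = ∧-≡true⁻ (X =ˢ ⊥) e in
             ∈ⁱ-resp I (sym (=ˢ⁻ X≡⊥)) (sym (=ˢ⁻ Y≡⊥)) (I-diag ⊥ ∅∈p))

  relabel-In : ∀ π N x → InC N x → InC (img π N) (relabelC π x)
  relabel-In π N 𝟘        _ = tt
  relabel-In π N (cp p I) c = record
    { p⊆N     = λ X e → subst (_⊆ img π N) (img-preimg π X) (img-mono π (⊆N e))
    ; ∅∈p     = ∈-resp p (sym (preimg-⊥ π)) ∅∈p
    ; N∈p     = ∈-resp p (sym (preimg-img π N)) N∈p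
    ; I-int   = λ X Y e → lower∈ e , upper∈ e , preimg-reflects-⊆ π (lower⊆upper e)
    ; I-ideal = λ X Y X′ Y′ e X′∈ Y′∈ X⊆X′ X′⊆Y′ Y′⊆Y →
                  I-ideal _ _ _ _ e X′∈ Y′∈
                          (preimg-mono π X⊆X′) (preimg-mono π X′⊆Y′) (preimg-mono π Y′⊆Y)
    ; I-diag  = λ X → I-diag (preimg π X)
    }
    where open Problem c

  relabel-id : ∀ N x → InC N x → relabelC Perm.id x ≈C x
  relabel-id N 𝟘        _ = tt
  relabel-id N (cp p I) _ =
    (λ X → cong p (preimg-id X)) , (λ X Y → cong₂ I (preimg-id X) (preimg-id Y))

  relabel-∘ : ∀ π ρ N x → InC N x → relabelC (π ∘ₚ ρ) x ≈C relabelC ρ (relabelC π x)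
  relabel-∘ π ρ N 𝟘        _ = tt
  relabel-∘ π ρ N (cp p I) _ =
    (λ X → cong p (preimg-∘ π ρ X)) , (λ X Y → cong₂ I (preimg-∘ π ρ X) (preimg-∘ π ρ Y))

  isPointedSpecies : IsPointedSpecies 𝐂
  isPointedSpecies = record
    { In-𝟘       = λ _ → tt
    ; In-𝟙       = In-𝟙
    ; In-∅       = In-∅
    ; relabel-In = relabel-In
    ; relabel-𝟘  = λ _ → tt
    ; relabel-id = relabel-id
    ; relabel-∘  = relabel-∘
    }

  module DisjointProblems {M N p I q J} (M#N : Disjoint M N)
                          (cx : IsColoringProblem M p I) (cy : IsColoringProblem N q J) where
    module A = Problem cx
    module B = Problem cy

    split-⊆ : ∀ {X Y X′ Y′} → p X ≡ true → q Y ≡ true → p X′ ≡ true → q Y′ ≡ true →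
              X ∪ Y ⊆ X′ ∪ Y′ → X ⊆ X′ × Y ⊆ Y′
    split-⊆ X∈ Y∈ X′∈ Y′∈ = ∪-⊆-componentwise M#N (A.⊆N X∈) (B.⊆N Y∈) (A.⊆N X′∈) (B.⊆N Y′∈)

    split-≡ : ∀ {X Y X′ Y′} → p X ≡ true → q Y ≡ true → p X′ ≡ true → q Y′ ≡ true →
              X ∪ Y ≡ X′ ∪ Y′ → X ≡ X′ × Y ≡ Y′
    split-≡ X∈ Y∈ X′∈ Y′∈ = ∪-≡-componentwise M#N (A.⊆N X∈) (B.⊆N Y∈) (A.⊆N X′∈) (B.⊆N Y′∈)

    ⊗-ideal : ∀ Z₁ Z₂ Z₁′ Z₂′ → (I ⊗ⁱ J) Z₁ Z₂ ≡ true →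
              (p ⊗ᶠ q) Z₁′ ≡ true → (p ⊗ᶠ q) Z₂′ ≡ true →
              Z₁ ⊆ Z₁′ → Z₁′ ⊆ Z₂′ → Z₂′ ⊆ Z₂ → (I ⊗ⁱ J) Z₁′ Z₂′ ≡ true
    ⊗-ideal Z₁ Z₂ Z₁′ Z₂′ e a b h₁ h₂ h₃ with ⊗ⁱ⁻ I J e | ⊗ᶠ⁻ p q a | ⊗ᶠ⁻ p q b
    ... | isplit X X′ Y Y′ i j e₁ e₂ | split A B A∈ B∈ eA | split A′ B′ A′∈ B′∈ eB =
      let X⊆A   , Y⊆B   = split-⊆ (A.lower∈ i) (B.lower∈ j) A∈ B∈ (subst₂ _⊆_ e₁ eA h₁)
          A⊆A′  , B⊆B′  = split-⊆ A∈ B∈ A′∈ B′∈ (subst₂ _⊆_ eA eB h₂)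
          A′⊆X′ , B′⊆Y′ = split-⊆ A′∈ B′∈ (A.upper∈ i) (B.upper∈ j) (subst₂ _⊆_ eB e₂ h₃)
      in ⊗ⁱ⁺ I J (isplit A A′ B B′ (A.I-ideal _ _ _ _ i A∈ A′∈ X⊆A A⊆A′ A′⊆X′)
                               (B.I-ideal _ _ _ _ j B∈ B′∈ Y⊆B B⊆B′ B′⊆Y′) eA eB)

  ·-In : ∀ M N x y → Disjoint M N → InC M x → InC N y → InC (M ∪ N) (x ·C y)
  ·-In M N 𝟘        y        _   _  _  = tt
  ·-In M N (cp p I) 𝟘        _   _  _  = tt
  ·-In M N (cp p I) (cp q J) M#N cx cy = record
    { p⊆N     = λ Z e → let split X Y X∈ Y∈ Z≡ = ⊗ᶠ⁻ p q e in
                  subst (_⊆ M ∪ N) (sym Z≡) (∪-mono (A.⊆N X∈) (B.⊆N Y∈))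
    ; ∅∈p     = ⊗ᶠ⁺ p q (split ⊥ ⊥ A.∅∈p B.∅∈p (sym (∪-identityˡ ⊥)))
    ; N∈p     = ⊗ᶠ⁺ p q (split M N A.N∈p B.N∈p refl)
    ; I-int   = λ Z Z′ e → let isplit X X′ Y Y′ i j e₁ e₂ = ⊗ⁱ⁻ I J e in
                  ⊗ᶠ⁺ p q (split X Y (A.lower∈ i) (B.lower∈ j) e₁) ,
                  ⊗ᶠ⁺ p q (split X′ Y′ (A.upper∈ i) (B.upper∈ j) e₂) ,
                  subst₂ _⊆_ (sym e₁) (sym e₂) (∪-mono (A.lower⊆upper i) (B.lower⊆upper j))
    ; I-ideal = ⊗-ideal
    ; I-diag  = λ Z e → let split X Y X∈ Y∈ Z≡ = ⊗ᶠ⁻ p q e in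
                  ⊗ⁱ⁺ I J (isplit X X Y Y (A.I-diag X X∈) (B.I-diag Y Y∈) Z≡ Z≡)
    }
    where open DisjointProblems M#N cx cy

  module _ (π : Permutation′ k) where

    private
      img-split : ∀ {Z X Y} → preimg π Z ≡ X ∪ Y → Z ≡ img π X ∪ img π Y
      img-split {Z} {X} {Y} e =
        trans (sym (img-preimg π Z)) (trans (cong (img π) e) (img-∪ π X Y))

      preimg-split : ∀ {Z X Y} → Z ≡ X ∪ Y → preimg π Z ≡ preimg π X ∪ preimg π Y
      preimg-split {X = X} {Y} e = trans (cong (preimg π) e) (preimg-∪ π X Y)

      back : ∀ (p : Family) {X} → p X ≡ true → p (preimg π (img π X)) ≡ true
      back p {X} = ∈-resp p (sym (preimg-img π X))

      backⁱ : ∀ (I : Intervals) {X Y} → I X Y ≡ true →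
              I (preimg π (img π X)) (preimg π (img π Y)) ≡ true
      backⁱ I {X} {Y} = ∈ⁱ-resp I (sym (preimg-img π X)) (sym (preimg-img π Y))

    relabelᶠ : Family → Family
    relabelᶠ p X = p (preimg π X)

    relabelⁱ : Intervals → Intervals
    relabelⁱ I X Y = I (preimg π X) (preimg π Y)

    ⊗ᶠ-relabel : ∀ p q Z → (p ⊗ᶠ q) (preimg π Z) ≡ (relabelᶠ p ⊗ᶠ relabelᶠ q) Z
    ⊗ᶠ-relabel p q Z = ≡true-ext
      (λ e → let split X Y X∈ Y∈ Z≡ = ⊗ᶠ⁻ p q e in
             ⊗ᶠ⁺ (relabelᶠ p) (relabelᶠ q)
               (split (img π X) (img π Y) (back p X∈) (back q Y∈) (img-split Z≡)))
      (λ e → let split X Y X∈ Y∈ Z≡ = ⊗ᶠ⁻ (relabelᶠ p) (relabelᶠ q) e in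
             ⊗ᶠ⁺ p q (split (preimg π X) (preimg π Y) X∈ Y∈ (preimg-split Z≡)))

    ⊗ⁱ-relabel : ∀ I J Z Z′ →
                 (I ⊗ⁱ J) (preimg π Z) (preimg π Z′) ≡ (relabelⁱ I ⊗ⁱ relabelⁱ J) Z Z′
    ⊗ⁱ-relabel I J Z Z′ = ≡true-ext
      (λ e → let isplit X X′ Y Y′ i j e₁ e₂ = ⊗ⁱ⁻ I J {preimg π Z} {preimg π Z′} e in
             ⊗ⁱ⁺ (relabelⁱ I) (relabelⁱ J) {Z} {Z′}
               (isplit (img π X) (img π X′) (img π Y) (img π Y′)
                       (backⁱ I i) (backⁱ J j) (img-split e₁) (img-split e₂)))
      (λ e → let isplit X X′ Y Y′ i j e₁ e₂ = ⊗ⁱ⁻ (relabelⁱ I) (relabelⁱ J) {Z} {Z′} e in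
             ⊗ⁱ⁺ I J {preimg π Z} {preimg π Z′}
               (isplit (preimg π X) (preimg π X′) (preimg π Y) (preimg π Y′)
                       i j (preimg-split e₁) (preimg-split e₂)))

  ·-natural : ∀ π M N x y → Disjoint M N → InC M x → InC N y →
              relabelC π (x ·C y) ≈C (relabelC π x ·C relabelC π y)
  ·-natural π M N 𝟘        y        _ _ _ = tt
  ·-natural π M N (cp p I) 𝟘        _ _ _ = tt
  ·-natural π M N (cp p I) (cp q J) _ _ _ = ⊗ᶠ-relabel π p q , ⊗ⁱ-relabel π I J

  ⊗ᶠ-assoc : ∀ p q r Z → ((p ⊗ᶠ q) ⊗ᶠ r) Z ≡ (p ⊗ᶠ (q ⊗ᶠ r)) Z
  ⊗ᶠ-assoc p q r Z = ≡true-ext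
    (λ e → let split W C W∈ C∈ Z≡ = ⊗ᶠ⁻ (p ⊗ᶠ q) r e
               split A B A∈ B∈ W≡ = ⊗ᶠ⁻ p q W∈ in
           ⊗ᶠ⁺ p (q ⊗ᶠ r) (split A (B ∪ C) A∈ (⊗ᶠ⁺ q r (split B C B∈ C∈ refl))
             (trans Z≡ (trans (cong (_∪ C) W≡) (∪-assoc A B C)))))
    (λ e → let split A W A∈ W∈ Z≡ = ⊗ᶠ⁻ p (q ⊗ᶠ r) e
               split B C B∈ C∈ W≡ = ⊗ᶠ⁻ q r W∈ in
           ⊗ᶠ⁺ (p ⊗ᶠ q) r (split (A ∪ B) C (⊗ᶠ⁺ p q (split A B A∈ B∈ refl)) C∈
             (trans Z≡ (trans (cong (A ∪_) W≡) (sym (∪-assoc A B C))))))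

  ⊗ⁱ-assoc : ∀ I J K Z Z′ → ((I ⊗ⁱ J) ⊗ⁱ K) Z Z′ ≡ (I ⊗ⁱ (J ⊗ⁱ K)) Z Z′
  ⊗ⁱ-assoc I J K Z Z′ = ≡true-ext
    (λ e → let isplit W W′ C C′ W∈ C∈ e₁ e₂ = ⊗ⁱ⁻ (I ⊗ⁱ J) K {Z} {Z′} e
               isplit A A′ B B′ A∈ B∈ f₁ f₂ = ⊗ⁱ⁻ I J W∈ in
           ⊗ⁱ⁺ I (J ⊗ⁱ K) {Z} {Z′} (isplit A A′ (B ∪ C) (B′ ∪ C′) A∈
             (⊗ⁱ⁺ J K (isplit B B′ C C′ B∈ C∈ refl refl))
             (trans e₁ (trans (cong (_∪ C) f₁) (∪-assoc A B C)))
             (trans e₂ (trans (cong (_∪ C′) f₂) (∪-assoc A′ B′ C′)))))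
    (λ e → let isplit A A′ W W′ A∈ W∈ e₁ e₂ = ⊗ⁱ⁻ I (J ⊗ⁱ K) {Z} {Z′} e
               isplit B B′ C C′ B∈ C∈ f₁ f₂ = ⊗ⁱ⁻ J K W∈ in
           ⊗ⁱ⁺ (I ⊗ⁱ J) K {Z} {Z′} (isplit (A ∪ B) (A′ ∪ B′) C C′
             (⊗ⁱ⁺ I J (isplit A A′ B B′ A∈ B∈ refl refl)) C∈
             (trans e₁ (trans (cong (A ∪_) f₁) (sym (∪-assoc A B C))))
             (trans e₂ (trans (cong (A′ ∪_) f₂) (sym (∪-assoc A′ B′ C′))))))

  ·-assoc : ∀ L M N x y z → Disjoint L M → Disjoint L N → Disjoint M N →
            InC L x → InC M y → InC N z → ((x ·C y) ·C z) ≈C (x ·C (y ·C z))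
  ·-assoc L M N 𝟘        y        z        _ _ _ _ _ _ = tt
  ·-assoc L M N (cp p I) 𝟘        z        _ _ _ _ _ _ = tt
  ·-assoc L M N (cp p I) (cp q J) 𝟘        _ _ _ _ _ _ = tt
  ·-assoc L M N (cp p I) (cp q J) (cp r K) _ _ _ _ _ _ = ⊗ᶠ-assoc p q r , ⊗ⁱ-assoc I J K

  𝟙ᶠ : Family
  𝟙ᶠ X = X =ˢ ⊥

  𝟙ⁱ : Intervals
  𝟙ⁱ X Y = 𝟙ᶠ X ∧ 𝟙ᶠ Y

  ⊥∈𝟙ᶠ : 𝟙ᶠ ⊥ ≡ true
  ⊥∈𝟙ᶠ = =ˢ⁺ {X = ⊥} refl

  𝟙ᶠ-∪ˡ : ∀ {Z X Y} → 𝟙ᶠ X ≡ true → Z ≡ X ∪ Y → Z ≡ Y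
  𝟙ᶠ-∪ˡ {Y = Y} X≡⊥ Z≡ = trans Z≡ (trans (cong (_∪ Y) (=ˢ⁻ X≡⊥)) (∪-identityˡ Y))

  𝟙ᶠ-∪ʳ : ∀ {Z X Y} → 𝟙ᶠ Y ≡ true → Z ≡ X ∪ Y → Z ≡ X
  𝟙ᶠ-∪ʳ {X = X} Y≡⊥ Z≡ = trans Z≡ (trans (cong (X ∪_) (=ˢ⁻ Y≡⊥)) (∪-identityʳ X))

  ⊗ᶠ-identityˡ : ∀ p Z → (𝟙ᶠ ⊗ᶠ p) Z ≡ p Z
  ⊗ᶠ-identityˡ p Z = ≡true-ext
    (λ e → let split X Y X≡⊥ Y∈ Z≡ = ⊗ᶠ⁻ 𝟙ᶠ p e in
           ∈-resp p (sym (𝟙ᶠ-∪ˡ X≡⊥ Z≡)) Y∈)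
    (λ e → ⊗ᶠ⁺ 𝟙ᶠ p (split ⊥ Z ⊥∈𝟙ᶠ e (sym (∪-identityˡ Z))))

  ⊗ᶠ-identityʳ : ∀ p Z → (p ⊗ᶠ 𝟙ᶠ) Z ≡ p Z
  ⊗ᶠ-identityʳ p Z = ≡true-ext
    (λ e → let split X Y X∈ Y≡⊥ Z≡ = ⊗ᶠ⁻ p 𝟙ᶠ e in
           ∈-resp p (sym (𝟙ᶠ-∪ʳ Y≡⊥ Z≡)) X∈)
    (λ e → ⊗ᶠ⁺ p 𝟙ᶠ (split Z ⊥ e ⊥∈𝟙ᶠ (sym (∪-identityʳ Z))))

  ⊗ⁱ-identityˡ : ∀ I Z Z′ → (𝟙ⁱ ⊗ⁱ I) Z Z′ ≡ I Z Z′
  ⊗ⁱ-identityˡ I Z Z′ = ≡true-ext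
    (λ e → let isplit X X′ Y Y′ XX′∈ YY′∈ e₁ e₂ = ⊗ⁱ⁻ 𝟙ⁱ I e
               X≡⊥ , X′≡⊥ = ∧-≡true⁻ (𝟙ᶠ X) XX′∈ in
           ∈ⁱ-resp I (sym (𝟙ᶠ-∪ˡ X≡⊥ e₁)) (sym (𝟙ᶠ-∪ˡ X′≡⊥ e₂)) YY′∈)
    (λ e → ⊗ⁱ⁺ 𝟙ⁱ I (isplit ⊥ ⊥ Z Z′ (∧-≡true⁺ ⊥∈𝟙ᶠ ⊥∈𝟙ᶠ) e
                            (sym (∪-identityˡ Z)) (sym (∪-identityˡ Z′))))

  ⊗ⁱ-identityʳ : ∀ I Z Z′ → (I ⊗ⁱ 𝟙ⁱ) Z Z′ ≡ I Z Z′
  ⊗ⁱ-identityʳ I Z Z′ = ≡true-ext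
    (λ e → let isplit X X′ Y Y′ XX′∈ YY′∈ e₁ e₂ = ⊗ⁱ⁻ I 𝟙ⁱ e
               Y≡⊥ , Y′≡⊥ = ∧-≡true⁻ (𝟙ᶠ Y) YY′∈ in
           ∈ⁱ-resp I (sym (𝟙ᶠ-∪ʳ Y≡⊥ e₁)) (sym (𝟙ᶠ-∪ʳ Y′≡⊥ e₂)) XX′∈)
    (λ e → ⊗ⁱ⁺ I 𝟙ⁱ (isplit Z Z′ ⊥ ⊥ e (∧-≡true⁺ ⊥∈𝟙ᶠ ⊥∈𝟙ᶠ)
                            (sym (∪-identityʳ Z)) (sym (∪-identityʳ Z′))))

  isMonoid : IsMonoid 𝐂
  isMonoid = record
    { ·-In      = ·-In
    ; ·-natural = ·-natural
    ; ·-assoc   = ·-assoc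
    ; ·-unitˡ   = λ { N 𝟘 _ → tt ; N (cp p I) _ → ⊗ᶠ-identityˡ p , ⊗ⁱ-identityˡ I }
    ; ·-unitʳ   = λ { N 𝟘 _ → tt ; N (cp p I) _ → ⊗ᶠ-identityʳ p , ⊗ⁱ-identityʳ I }
    ; ·-𝟘ˡ      = λ _ _ _ → tt
    ; ·-𝟘ʳ      = λ { N 𝟘 _ → tt ; N (cp p I) _ → tt }
    }

  restr-In : ∀ N S x → S ⊆ N → InC N x → InC S (restrC N S x)
  restr-In N S 𝟘        _ _ = tt
  restr-In N S (cp p I) _ c with p S in S∈p
  ... | false = tt
  ... | true  = record
    { p⊆N     = λ T e → ⊆ᵇ⁻ (proj₂ (∧-≡true⁻ (p T) e))
    ; ∅∈p     = ∧-≡true⁺ ∅∈p (⊆ᵇ⁺ ⊥⊆)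
    ; N∈p     = ∧-≡true⁺ S∈p (⊆ᵇ⁺ ⊆-refl)
    ; I-int   = λ X Y e → let i , Y⊆S = ∧-≡true⁻ (I X Y) e in
                  ∧-≡true⁺ (lower∈ i) (⊆ᵇ⁺ (⊆-trans (lower⊆upper i) (⊆ᵇ⁻ Y⊆S))) ,
                  ∧-≡true⁺ (upper∈ i) Y⊆S , lower⊆upper i
    ; I-ideal = λ X Y X′ Y′ e X′∈ Y′∈ X⊆X′ X′⊆Y′ Y′⊆Y →
                  let i , Y⊆S = ∧-≡true⁻ (I X Y) e
                      X′∈p = proj₁ (∧-≡true⁻ (p X′) X′∈)
                      Y′∈p = proj₁ (∧-≡true⁻ (p Y′) Y′∈) in
                  ∧-≡true⁺ (I-ideal X Y X′ Y′ i X′∈p Y′∈p X⊆X′ X′⊆Y′ Y′⊆Y) (⊆ᵇ⁺ (⊆-trans Y′⊆Y (⊆ᵇ⁻ Y⊆S)))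
    ; I-diag  = λ X e → let X∈ , X⊆S = ∧-≡true⁻ (p X) e in ∧-≡true⁺ (I-diag X X∈) X⊆S
    }
    where open Problem c

  contr-In : ∀ N S x → S ⊆ N → InC N x → InC (N ─ S) (contrC N S x)
  contr-In N S 𝟘        _   _ = tt
  contr-In N S (cp p I) S⊆N c with p S in S∈p
  ... | false = tt
  ... | true  = record
    { p⊆N     = λ X e → ⊆ᵇ⁻ (proj₁ (∧-≡true⁻ (X ⊆ᵇ (N ─ S)) e))
    ; ∅∈p     = ∧-≡true⁺ (⊆ᵇ⁺ ⊥⊆) (∈-resp p (sym (∪-identityˡ S)) S∈p)
    ; N∈p     = ∧-≡true⁺ (⊆ᵇ⁺ ⊆-refl) (∈-resp p (sym (─-∪-cancel S⊆N)) N∈p)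
    ; I-int   = λ X Y e → let X⊆Y , e′ = ∧-≡true⁻ (X ⊆ᵇ Y) e
                              Y⊆N─S , i = ∧-≡true⁻ (Y ⊆ᵇ (N ─ S)) e′ in
                  ∧-≡true⁺ (⊆ᵇ⁺ (⊆-trans (⊆ᵇ⁻ X⊆Y) (⊆ᵇ⁻ Y⊆N─S))) (lower∈ i) ,
                  ∧-≡true⁺ Y⊆N─S (upper∈ i) , ⊆ᵇ⁻ X⊆Y
    ; I-ideal = λ X Y X′ Y′ e X′∈ Y′∈ X⊆X′ X′⊆Y′ Y′⊆Y →
                  let i = proj₂ (∧-≡true⁻ (Y ⊆ᵇ (N ─ S)) (proj₂ (∧-≡true⁻ (X ⊆ᵇ Y) e)))
                      Y′⊆N─S , Y′∪S∈ = ∧-≡true⁻ (Y′ ⊆ᵇ (N ─ S)) Y′∈ in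
                  ∧-≡true⁺ (⊆ᵇ⁺ X′⊆Y′) (∧-≡true⁺ Y′⊆N─S
                    (I-ideal _ _ _ _ i (proj₂ (∧-≡true⁻ (X′ ⊆ᵇ (N ─ S)) X′∈)) Y′∪S∈
                      (∪-mono X⊆X′ ⊆-refl) (∪-mono X′⊆Y′ ⊆-refl) (∪-mono Y′⊆Y ⊆-refl)))
    ; I-diag  = λ X e → let X⊆N─S , X∪S∈ = ∧-≡true⁻ (X ⊆ᵇ (N ─ S)) e in
                  ∧-≡true⁺ (⊆ᵇ⁺ {X = X} ⊆-refl) (∧-≡true⁺ X⊆N─S (I-diag (X ∪ S) X∪S∈))
    }
    where open Problem c

  module _ (π : Permutation′ k) where

    private
      S∈relabel : ∀ p {S} → p S ≡ true → relabelᶠ π p (img π S) ≡ true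
      S∈relabel p {S} = ∈-resp p (sym (preimg-img π S))

      S∉relabel : ∀ p {S} → p S ≡ false → relabelᶠ π p (img π S) ≡ false
      S∉relabel p {S} e = trans (cong p (preimg-img π S)) e

    restr-natural : ∀ N S x → S ⊆ N → InC N x →
                    relabelC π (restrC N S x) ≈C restrC (img π N) (img π S) (relabelC π x)
    restr-natural N S 𝟘        _ _ = tt
    restr-natural N S (cp p I) _ _ with true-or-false (p S)
    ... | inj₂ S∉p = ≈C-resp-≡ (cong (relabelC π) (restrC-∉ N S p I S∉p))
                               (restrC-∉ (img π N) (img π S) p′ I′ (S∉relabel p S∉p)) tt
      where p′ = relabelᶠ π p ; I′ = relabelⁱ π I
    ... | inj₁ S∈p = ≈C-resp-≡ (cong (relabelC π) (restrC-∈ N S p I S∈p))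
                               (restrC-∈ (img π N) (img π S) p′ I′ (S∈relabel p S∈p))
                               ( (λ X → cong (p′ X ∧_) (preimg-⊆ᵇ-img π X S))
                               , (λ X Y → cong (I′ X Y ∧_) (preimg-⊆ᵇ-img π Y S)))
      where p′ = relabelᶠ π p ; I′ = relabelⁱ π I

    contr-natural : ∀ N S x → S ⊆ N → InC N x →
                    relabelC π (contrC N S x) ≈C contrC (img π N) (img π S) (relabelC π x)
    contr-natural N S 𝟘        _ _ = tt
    contr-natural N S (cp p I) _ _ with true-or-false (p S)
    ... | inj₂ S∉p = ≈C-resp-≡ (cong (relabelC π) (contrC-∉ N S p I S∉p))
                               (contrC-∉ (img π N) (img π S) p′ I′ (S∉relabel p S∉p)) tt
      where p′ = relabelᶠ π p ; I′ = relabelⁱ π I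
    ... | inj₁ S∈p = ≈C-resp-≡ (cong (relabelC π) (contrC-∈ N S p I S∈p))
                               (contrC-∈ (img π N) (img π S) p′ I′ (S∈relabel p S∈p))
                               ( (λ X → cong₂ _∧_ (⊆ᵇN─S X) (cong p (∪S X)))
                               , (λ X Y → cong₂ _∧_ (preimg-⊆ᵇ π X Y)
                                                    (cong₂ _∧_ (⊆ᵇN─S Y) (cong₂ I (∪S X) (∪S Y)))))
      where
      p′ = relabelᶠ π p
      I′ = relabelⁱ π I
      ⊆ᵇN─S : ∀ X → (preimg π X ⊆ᵇ (N ─ S)) ≡ (X ⊆ᵇ (img π N ─ img π S))
      ⊆ᵇN─S X = trans (preimg-⊆ᵇ-img π X (N ─ S)) (cong (X ⊆ᵇ_) (img-─ π N S))
      ∪S : ∀ X → preimg π X ∪ S ≡ preimg π (X ∪ img π S)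
      ∪S X = sym (trans (preimg-∪ π X (img π S)) (cong (preimg π X ∪_) (preimg-img π S)))

  module Composites {N S R : Subset k} (R⊆S : R ⊆ S) (S⊆N : S ⊆ N)
                    (p : Family) (I : Intervals) where

    private
      p∣S = restrictᶠ p S
      I∣S = restrictⁱ I S
      p/R = contractᶠ N R p
      I/R = contractⁱ N R I

    R∈restrictᶠ : restrictᶠ p S R ≡ p R
    R∈restrictᶠ = trans (cong (p R ∧_) (⊆ᵇ⁺ R⊆S)) (Bool.∧-identityʳ (p R))

    S─R∈contractᶠ : contractᶠ N R p (S ─ R) ≡ p S
    S─R∈contractᶠ = cong₂ _∧_ (⊆ᵇ⁺ (─-monoˡ R S⊆N)) (cong p (─-∪-cancel R⊆S))

    contr∘restr-∈ : p S ≡ true → p R ≡ true →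
                    contrC S R (restrC N S (cp p I)) ≡ cp (contractᶠ S R p∣S) (contractⁱ S R I∣S)
    contr∘restr-∈ S∈p R∈p = trans (cong (contrC S R) (restrC-∈ N S p I S∈p))
                                  (contrC-∈ S R p∣S I∣S (trans R∈restrictᶠ R∈p))

    contr∘restr-∉ : p S ≡ false ⊎ p R ≡ false → contrC S R (restrC N S (cp p I)) ≡ 𝟘
    contr∘restr-∉ (inj₁ S∉p) = cong (contrC S R) (restrC-∉ N S p I S∉p)
    contr∘restr-∉ (inj₂ R∉p) with true-or-false (p S)
    ... | inj₂ S∉p = cong (contrC S R) (restrC-∉ N S p I S∉p)
    ... | inj₁ S∈p = trans (cong (contrC S R) (restrC-∈ N S p I S∈p))
                           (contrC-∉ S R p∣S I∣S (trans R∈restrictᶠ R∉p))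

    restr∘contr-∈ : p S ≡ true → p R ≡ true →
                    restrC (N ─ R) (S ─ R) (contrC N R (cp p I))
                      ≡ cp (restrictᶠ p/R (S ─ R)) (restrictⁱ I/R (S ─ R))
    restr∘contr-∈ S∈p R∈p = trans (cong (restrC (N ─ R) (S ─ R)) (contrC-∈ N R p I R∈p))
                                  (restrC-∈ (N ─ R) (S ─ R) p/R I/R (trans S─R∈contractᶠ S∈p))

    restr∘contr-∉ : p S ≡ false ⊎ p R ≡ false → restrC (N ─ R) (S ─ R) (contrC N R (cp p I)) ≡ 𝟘
    restr∘contr-∉ (inj₂ R∉p) = cong (restrC (N ─ R) (S ─ R)) (contrC-∉ N R p I R∉p)
    restr∘contr-∉ (inj₁ S∉p) with true-or-false (p R)
    ... | inj₂ R∉p = cong (restrC (N ─ R) (S ─ R)) (contrC-∉ N R p I R∉p)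
    ... | inj₁ R∈p = trans (cong (restrC (N ─ R) (S ─ R)) (contrC-∈ N R p I R∈p))
                           (restrC-∉ (N ─ R) (S ─ R) p/R I/R (trans S─R∈contractᶠ S∉p))

    restr∘restr-∈ : p S ≡ true → p R ≡ true →
                    restrC S R (restrC N S (cp p I)) ≡ cp (restrictᶠ p∣S R) (restrictⁱ I∣S R)
    restr∘restr-∈ S∈p R∈p = trans (cong (restrC S R) (restrC-∈ N S p I S∈p))
                                  (restrC-∈ S R p∣S I∣S (trans R∈restrictᶠ R∈p))

    contr∘contr-∈ : p S ≡ true → p R ≡ true →
                    contrC (N ─ R) (S ─ R) (contrC N R (cp p I))
                      ≡ cp (contractᶠ (N ─ R) (S ─ R) p/R) (contractⁱ (N ─ R) (S ─ R) I/R)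
    contr∘contr-∈ S∈p R∈p = trans (cong (contrC (N ─ R) (S ─ R)) (contrC-∈ N R p I R∈p))
                                  (contrC-∈ (N ─ R) (S ─ R) p/R I/R (trans S─R∈contractᶠ S∈p))

    contr∘restr-≉𝟘 : ¬ (contrC S R (restrC N S (cp p I)) ≈C 𝟘) → p S ≡ true × p R ≡ true
    contr∘restr-≉𝟘 nz with both-true-or-one-false (p S) (p R)
    ... | inj₁ both = both
    ... | inj₂ one  = contradiction (≈C-resp-≡ (contr∘restr-∉ one) refl tt) nz

  coassoc-mixed : ∀ N S R x → R ⊆ S → S ⊆ N → InC N x →
                  contrC S R (restrC N S x) ≈C restrC (N ─ R) (S ─ R) (contrC N R x)
  coassoc-mixed N S R 𝟘        _   _   _ = tt
  coassoc-mixed N S R (cp p I) R⊆S S⊆N _ with both-true-or-one-false (p S) (p R)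
  ... | inj₂ one = ≈C-resp-≡ (contr∘restr-∉ one) (restr∘contr-∉ one) tt
    where open Composites R⊆S S⊆N p I
  ... | inj₁ (S∈p , R∈p) =
    ≈C-resp-≡ (contr∘restr-∈ S∈p R∈p) (restr∘contr-∈ S∈p R∈p) (family , intervals)
    where
    open Composites R⊆S S⊆N p I
    ⊆N─R : ∀ {X} → X ⊆ᵇ (S ─ R) ≡ true → X ⊆ᵇ (N ─ R) ≡ true
    ⊆N─R e = ⊆ᵇ⁺ (⊆-trans (⊆ᵇ⁻ e) (─-monoˡ R S⊆N))
    ∪R⊆S : ∀ {X} → X ⊆ᵇ (S ─ R) ≡ true → (X ∪ R) ⊆ᵇ S ≡ true
    ∪R⊆S e = ⊆ᵇ⁺ (⊆─⇒∪⊆ R⊆S (⊆ᵇ⁻ e))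
    family : ∀ X → contractᶠ S R (restrictᶠ p S) X ≡ restrictᶠ (contractᶠ N R p) (S ─ R) X
    family X = ≡true-ext
      (λ e → let X⊆S─R , e′ = ∧-≡true⁻ (X ⊆ᵇ (S ─ R)) e in
             ∧-≡true⁺ (∧-≡true⁺ (⊆N─R X⊆S─R) (proj₁ (∧-≡true⁻ (p (X ∪ R)) e′))) X⊆S─R)
      (λ e → let e′ , X⊆S─R = ∧-≡true⁻ ((X ⊆ᵇ (N ─ R)) ∧ p (X ∪ R)) e in
             ∧-≡true⁺ X⊆S─R (∧-≡true⁺ (proj₂ (∧-≡true⁻ (X ⊆ᵇ (N ─ R)) e′)) (∪R⊆S X⊆S─R)))
    intervals : ∀ X Y → contractⁱ S R (restrictⁱ I S) X Y ≡ restrictⁱ (contractⁱ N R I) (S ─ R) X Y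
    intervals X Y = ≡true-ext
      (λ e → let X⊆Y , e′ = ∧-≡true⁻ (X ⊆ᵇ Y) e
                 Y⊆S─R , e″ = ∧-≡true⁻ (Y ⊆ᵇ (S ─ R)) e′
                 XY∈I = proj₁ (∧-≡true⁻ (I (X ∪ R) (Y ∪ R)) e″) in
             ∧-≡true⁺ (∧-≡true⁺ X⊆Y (∧-≡true⁺ (⊆N─R Y⊆S─R) XY∈I)) Y⊆S─R)
      (λ e → let e′ , Y⊆S─R = ∧-≡true⁻ ((X ⊆ᵇ Y) ∧ (Y ⊆ᵇ (N ─ R)) ∧ I (X ∪ R) (Y ∪ R)) e
                 X⊆Y , e″ = ∧-≡true⁻ (X ⊆ᵇ Y) e′ in
             ∧-≡true⁺ X⊆Y (∧-≡true⁺ Y⊆S─R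
               (∧-≡true⁺ (proj₂ (∧-≡true⁻ (Y ⊆ᵇ (N ─ R)) e″)) (∪R⊆S Y⊆S─R))))

  coassoc-restr : ∀ N S R x → R ⊆ S → S ⊆ N → InC N x →
                  ¬ (contrC S R (restrC N S x) ≈C 𝟘) → restrC S R (restrC N S x) ≈C restrC N R x
  coassoc-restr N S R 𝟘        _   _   _ _  = tt
  coassoc-restr N S R (cp p I) R⊆S S⊆N _ nz =
    ≈C-resp-≡ (restr∘restr-∈ S∈p R∈p) (restrC-∈ N R p I R∈p) (family , intervals)
    where
    open Composites R⊆S S⊆N p I
    S∈p = proj₁ (contr∘restr-≉𝟘 nz)
    R∈p = proj₂ (contr∘restr-≉𝟘 nz)
    ⊆S : ∀ {X} → X ⊆ᵇ R ≡ true → X ⊆ᵇ S ≡ true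
    ⊆S e = ⊆ᵇ⁺ (⊆-trans (⊆ᵇ⁻ e) R⊆S)
    family : ∀ T → restrictᶠ (restrictᶠ p S) R T ≡ restrictᶠ p R T
    family T = ≡true-ext
      (λ e → let e′ , T⊆R = ∧-≡true⁻ (p T ∧ (T ⊆ᵇ S)) e in
             ∧-≡true⁺ (proj₁ (∧-≡true⁻ (p T) e′)) T⊆R)
      (λ e → let T∈p , T⊆R = ∧-≡true⁻ (p T) e in ∧-≡true⁺ (∧-≡true⁺ T∈p (⊆S T⊆R)) T⊆R)
    intervals : ∀ X Y → restrictⁱ (restrictⁱ I S) R X Y ≡ restrictⁱ I R X Y
    intervals X Y = ≡true-ext
      (λ e → let e′ , Y⊆R = ∧-≡true⁻ (I X Y ∧ (Y ⊆ᵇ S)) e in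
             ∧-≡true⁺ (proj₁ (∧-≡true⁻ (I X Y) e′)) Y⊆R)
      (λ e → let XY∈I , Y⊆R = ∧-≡true⁻ (I X Y) e in ∧-≡true⁺ (∧-≡true⁺ XY∈I (⊆S Y⊆R)) Y⊆R)

  coassoc-contr : ∀ N S R x → R ⊆ S → S ⊆ N → InC N x →
                  ¬ (contrC S R (restrC N S x) ≈C 𝟘) → contrC N S x ≈C contrC (N ─ R) (S ─ R) (contrC N R x)
  coassoc-contr N S R 𝟘        _   _   _ _  = tt
  coassoc-contr N S R (cp p I) R⊆S S⊆N _ nz =
    ≈C-resp-≡ (contrC-∈ N S p I S∈p) (contr∘contr-∈ S∈p R∈p) (family , intervals)
    where
    open Composites R⊆S S⊆N p I
    S∈p = proj₁ (contr∘restr-≉𝟘 nz)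
    R∈p = proj₂ (contr∘restr-≉𝟘 nz)
    N─S≡ : (N ─ R) ─ (S ─ R) ≡ N ─ S
    N─S≡ = ─-─-cancel R⊆S S⊆N
    ∪≡ : ∀ X → (X ∪ (S ─ R)) ∪ R ≡ X ∪ S
    ∪≡ X = ∪─-∪-cancel X R⊆S
    ⊆N─S : ∀ {X} → X ⊆ᵇ (N ─ S) ≡ true → X ⊆ᵇ ((N ─ R) ─ (S ─ R)) ≡ true
    ⊆N─S e = ⊆ᵇ⁺ (subst (_ ⊆_) (sym N─S≡) (⊆ᵇ⁻ e))
    ⊆N─S⁻ : ∀ {X} → X ⊆ᵇ ((N ─ R) ─ (S ─ R)) ≡ true → X ⊆ᵇ (N ─ S) ≡ true
    ⊆N─S⁻ e = ⊆ᵇ⁺ (subst (_ ⊆_) N─S≡ (⊆ᵇ⁻ e))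
    ∪⊆N─R : ∀ {X} → X ⊆ᵇ (N ─ S) ≡ true → (X ∪ (S ─ R)) ⊆ᵇ (N ─ R) ≡ true
    ∪⊆N─R e = ⊆ᵇ⁺ (∪─-⊆ R⊆S S⊆N (⊆ᵇ⁻ e))
    family : ∀ X → contractᶠ N S p X ≡ contractᶠ (N ─ R) (S ─ R) (contractᶠ N R p) X
    family X = ≡true-ext
      (λ e → let X⊆N─S , X∪S∈ = ∧-≡true⁻ (X ⊆ᵇ (N ─ S)) e in
             ∧-≡true⁺ (⊆N─S X⊆N─S) (∧-≡true⁺ (∪⊆N─R X⊆N─S) (∈-resp p (sym (∪≡ X)) X∪S∈)))
      (λ e → let X⊆ , e′ = ∧-≡true⁻ (X ⊆ᵇ ((N ─ R) ─ (S ─ R))) e in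
             ∧-≡true⁺ (⊆N─S⁻ X⊆) (∈-resp p (∪≡ X) (proj₂ (∧-≡true⁻ ((X ∪ (S ─ R)) ⊆ᵇ (N ─ R)) e′))))
    intervals : ∀ X Y → contractⁱ N S I X Y ≡ contractⁱ (N ─ R) (S ─ R) (contractⁱ N R I) X Y
    intervals X Y = ≡true-ext
      (λ e → let X⊆Y , e′ = ∧-≡true⁻ (X ⊆ᵇ Y) e
                 Y⊆N─S , XY∈I = ∧-≡true⁻ (Y ⊆ᵇ (N ─ S)) e′ in
             ∧-≡true⁺ X⊆Y (∧-≡true⁺ (⊆N─S Y⊆N─S)
               (∧-≡true⁺ (⊆ᵇ⁺ (∪-mono (⊆ᵇ⁻ X⊆Y) ⊆-refl)) (∧-≡true⁺ (∪⊆N─R Y⊆N─S)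
                 (∈ⁱ-resp I (sym (∪≡ X)) (sym (∪≡ Y)) XY∈I)))))
      (λ e → let X⊆Y , e′ = ∧-≡true⁻ (X ⊆ᵇ Y) e
                 Y⊆ , e″ = ∧-≡true⁻ (Y ⊆ᵇ ((N ─ R) ─ (S ─ R))) e′
                 _ , e‴ = ∧-≡true⁻ ((X ∪ (S ─ R)) ⊆ᵇ (Y ∪ (S ─ R))) e″
                 _ , XY∈I = ∧-≡true⁻ ((Y ∪ (S ─ R)) ⊆ᵇ (N ─ R)) e‴ in
             ∧-≡true⁺ X⊆Y (∧-≡true⁺ (⊆N─S⁻ Y⊆) (∈ⁱ-resp I (∪≡ X) (∪≡ Y) XY∈I)))

  counit-restr : ∀ N x → InC N x → restrC N N x ≈C x
  counit-restr N 𝟘        _ = tt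
  counit-restr N (cp p I) c = ≈C-resp-≡ (restrC-∈ N N p I N∈p) refl
    ( (λ T → ∧-redundantʳ (p T) (λ T∈ → ⊆ᵇ⁺ (⊆N T∈)))
    , (λ X Y → ∧-redundantʳ (I X Y) (λ XY∈ → ⊆ᵇ⁺ (⊆N (upper∈ XY∈)))))
    where open Problem c

  counit-contr : ∀ N x → InC N x → contrC N ⊥ x ≈C x
  counit-contr N 𝟘        _ = tt
  counit-contr N (cp p I) c = ≈C-resp-≡ (contrC-∈ N ⊥ p I ∅∈p) refl (family , intervals)
    where
    open Problem c
    family : ∀ X → contractᶠ N ⊥ p X ≡ p X
    family X = begin
      (X ⊆ᵇ (N ─ ⊥)) ∧ p (X ∪ ⊥)  ≡⟨ cong₂ (λ A B → (X ⊆ᵇ A) ∧ p B) (p─⊥≡p N) (∪-identityʳ X) ⟩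
      (X ⊆ᵇ N) ∧ p X              ≡⟨ ∧-redundantˡ (p X) (λ X∈ → ⊆ᵇ⁺ (⊆N X∈)) ⟩
      p X                         ∎
    intervals : ∀ X Y → contractⁱ N ⊥ I X Y ≡ I X Y
    intervals X Y = begin
      (X ⊆ᵇ Y) ∧ (Y ⊆ᵇ (N ─ ⊥)) ∧ I (X ∪ ⊥) (Y ∪ ⊥)
        ≡⟨ cong₂ (λ A B → (X ⊆ᵇ Y) ∧ (Y ⊆ᵇ A) ∧ B)
                 (p─⊥≡p N) (cong₂ I (∪-identityʳ X) (∪-identityʳ Y)) ⟩
      (X ⊆ᵇ Y) ∧ (Y ⊆ᵇ N) ∧ I X Y
        ≡⟨ cong ((X ⊆ᵇ Y) ∧_) (∧-redundantˡ (I X Y) (λ XY∈ → ⊆ᵇ⁺ (⊆N (upper∈ XY∈)))) ⟩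
      (X ⊆ᵇ Y) ∧ I X Y
        ≡⟨ ∧-redundantˡ (I X Y) (λ XY∈ → ⊆ᵇ⁺ (lower⊆upper XY∈)) ⟩
      I X Y ∎

  zero-iff : ∀ N S x → S ⊆ N → InC N x → (restrC N S x ≈C 𝟘) ⇔ (contrC N S x ≈C 𝟘)
  zero-iff N S 𝟘        _ _ = mk⇔ id id
  zero-iff N S (cp p I) _ _ with p S
  ... | false = mk⇔ id id
  ... | true  = mk⇔ (λ ()) (λ ())

  combinatorial : ∀ N S T x → S ⊆ T → T ⊆ N → InC N x →
                  ¬ (restrC N S x ≈C 𝟘) → ¬ (restrC N T x ≈C 𝟘) → ¬ (contrC T S (restrC N T x) ≈C 𝟘)
  combinatorial N S T 𝟘        _   _   _ S≉𝟘 _ = contradiction tt S≉𝟘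
  combinatorial N S T (cp p I) S⊆T T⊆N _ S≉𝟘 T≉𝟘 with true-or-false (p S) | true-or-false (p T)
  ... | inj₂ S∉p | _        = contradiction (≈C-resp-≡ (restrC-∉ N S p I S∉p) refl tt) S≉𝟘
  ... | inj₁ _   | inj₂ T∉p = contradiction (≈C-resp-≡ (restrC-∉ N T p I T∉p) refl tt) T≉𝟘
  ... | inj₁ S∈p | inj₁ T∈p = ≈C-resp-≡ (sym (contr∘restr-∈ T∈p S∈p)) refl
    where open Composites S⊆T T⊆N p I

  isComonoid : IsComonoid 𝐂
  isComonoid = record
    { restr-In      = restr-In
    ; contr-In      = contr-In
    ; restr-natural = restr-natural
    ; contr-natural = contr-natural
    ; coassoc-mixed = coassoc-mixed
    ; coassoc-restr = coassoc-restr
    ; coassoc-contr = coassoc-contr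
    ; counit-restr  = counit-restr
    ; counit-contr  = counit-contr
    ; zero-iff      = zero-iff
    ; restr-𝟘       = λ _ _ _ → tt
    ; contr-𝟘       = λ _ _ _ → tt
    }

  module ProductRestriction {S T S′ p I q J} (S#T : Disjoint S T)
                            (cx : IsColoringProblem S p I) (cy : IsColoringProblem T q J)
                            (S′⊆S∪T : S′ ⊆ S ∪ T) where
    open DisjointProblems S#T cx cy using (module A; module B)

    S₁ T₁ D : Subset k
    S₁ = S ∩ S′
    T₁ = T ∩ S′
    D  = (S ∪ T) ─ S′

    S′≡ : S′ ≡ S₁ ∪ T₁
    S′≡ = ⊆∪⇒≡∩∪∩ S′⊆S∪T

    recoverˡ : ∀ {Z X Y} → p X ≡ true → q Y ≡ true → Z ≡ X ∪ Y → S ∩ Z ≡ X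
    recoverˡ X∈ Y∈ Z≡ = trans (cong (S ∩_) Z≡) (∩-∪-cancelˡ S#T (A.⊆N X∈) (B.⊆N Y∈))

    recoverʳ : ∀ {Z X Y} → p X ≡ true → q Y ≡ true → Z ≡ X ∪ Y → T ∩ Z ≡ Y
    recoverʳ X∈ Y∈ Z≡ = trans (cong (T ∩_) Z≡) (∩-∪-cancelʳ S#T (A.⊆N X∈) (B.⊆N Y∈))

    S′∈⊗⁻ : (p ⊗ᶠ q) S′ ≡ true → p S₁ ≡ true × q T₁ ≡ true
    S′∈⊗⁻ e = let split X Y X∈ Y∈ S′≡X∪Y = ⊗ᶠ⁻ p q e in
      ∈-resp p (sym (recoverˡ X∈ Y∈ S′≡X∪Y)) X∈ , ∈-resp q (sym (recoverʳ X∈ Y∈ S′≡X∪Y)) Y∈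

    S′∈⊗⁺ : p S₁ ≡ true → q T₁ ≡ true → (p ⊗ᶠ q) S′ ≡ true
    S′∈⊗⁺ S₁∈ T₁∈ = ⊗ᶠ⁺ p q (split S₁ T₁ S₁∈ T₁∈ S′≡)

    private
      ⊆S₁ : ∀ {X Y} → p X ≡ true → X ∪ Y ⊆ S′ → X ⊆ S₁
      ⊆S₁ X∈ X∪Y⊆S′ = ⊆-∩ (A.⊆N X∈) (⊆-trans (p⊆p∪q _) X∪Y⊆S′)

      ⊆T₁ : ∀ {X Y} → q Y ≡ true → X ∪ Y ⊆ S′ → Y ⊆ T₁
      ⊆T₁ Y∈ X∪Y⊆S′ = ⊆-∩ (B.⊆N Y∈) (⊆-trans (q⊆p∪q _ _) X∪Y⊆S′)

      ⊆S′ : ∀ {Z X Y} → Z ≡ X ∪ Y → X ⊆ᵇ S₁ ≡ true → Y ⊆ᵇ T₁ ≡ true → Z ⊆ᵇ S′ ≡ true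
      ⊆S′ Z≡ X⊆ Y⊆ = ⊆ᵇ⁺ (subst₂ _⊆_ (sym Z≡) (sym S′≡) (∪-mono (⊆ᵇ⁻ X⊆) (⊆ᵇ⁻ Y⊆)))

    restrict-⊗ᶠ : ∀ Z → restrictᶠ (p ⊗ᶠ q) S′ Z ≡ (restrictᶠ p S₁ ⊗ᶠ restrictᶠ q T₁) Z
    restrict-⊗ᶠ Z = ≡true-ext
      (λ e → let Z∈ , Z⊆S′ = ∧-≡true⁻ ((p ⊗ᶠ q) Z) e
                 split X Y X∈ Y∈ Z≡ = ⊗ᶠ⁻ p q Z∈
                 X∪Y⊆S′ = subst (_⊆ S′) Z≡ (⊆ᵇ⁻ Z⊆S′) in
             ⊗ᶠ⁺ (restrictᶠ p S₁) (restrictᶠ q T₁)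
               (split X Y (∧-≡true⁺ X∈ (⊆ᵇ⁺ (⊆S₁ X∈ X∪Y⊆S′)))
                          (∧-≡true⁺ Y∈ (⊆ᵇ⁺ (⊆T₁ Y∈ X∪Y⊆S′))) Z≡))
      (λ e → let split X Y X∈′ Y∈′ Z≡ = ⊗ᶠ⁻ (restrictᶠ p S₁) (restrictᶠ q T₁) e
                 X∈ , X⊆ = ∧-≡true⁻ (p X) X∈′
                 Y∈ , Y⊆ = ∧-≡true⁻ (q Y) Y∈′ in
             ∧-≡true⁺ (⊗ᶠ⁺ p q (split X Y X∈ Y∈ Z≡)) (⊆S′ Z≡ X⊆ Y⊆))

    restrict-⊗ⁱ : ∀ Z Z′ → restrictⁱ (I ⊗ⁱ J) S′ Z Z′ ≡ (restrictⁱ I S₁ ⊗ⁱ restrictⁱ J T₁) Z Z′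
    restrict-⊗ⁱ Z Z′ = ≡true-ext
      (λ e → let ZZ′∈ , Z′⊆S′ = ∧-≡true⁻ ((I ⊗ⁱ J) Z Z′) e
                 isplit X X′ Y Y′ i j Z≡ Z′≡ = ⊗ⁱ⁻ I J ZZ′∈
                 X′∪Y′⊆S′ = subst (_⊆ S′) Z′≡ (⊆ᵇ⁻ Z′⊆S′) in
             ⊗ⁱ⁺ (restrictⁱ I S₁) (restrictⁱ J T₁) {Z} {Z′} (isplit X X′ Y Y′
               (∧-≡true⁺ i (⊆ᵇ⁺ (⊆S₁ (A.upper∈ i) X′∪Y′⊆S′)))
               (∧-≡true⁺ j (⊆ᵇ⁺ (⊆T₁ (B.upper∈ j) X′∪Y′⊆S′))) Z≡ Z′≡))
      (λ e → let isplit X X′ Y Y′ i′ j′ Z≡ Z′≡ = ⊗ⁱ⁻ (restrictⁱ I S₁) (restrictⁱ J T₁) {Z} {Z′} e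
                 i , X′⊆ = ∧-≡true⁻ (I X X′) i′
                 j , Y′⊆ = ∧-≡true⁻ (J Y Y′) j′ in
             ∧-≡true⁺ (⊗ⁱ⁺ I J (isplit X X′ Y Y′ i j Z≡ Z′≡)) (⊆S′ Z′≡ X′⊆ Y′⊆))

    private
      ∪S₁≡ : ∀ {Z X Y} → p X ≡ true → q Y ≡ true → Z ∪ S′ ≡ X ∪ Y → (S ∩ Z) ∪ S₁ ≡ X
      ∪S₁≡ {Z} X∈ Y∈ e = trans (sym (∩-distribˡ-∪ S Z S′)) (recoverˡ X∈ Y∈ e)

      ∪T₁≡ : ∀ {Z X Y} → p X ≡ true → q Y ≡ true → Z ∪ S′ ≡ X ∪ Y → (T ∩ Z) ∪ T₁ ≡ Y
      ∪T₁≡ {Z} X∈ Y∈ e = trans (sym (∩-distribˡ-∪ T Z S′)) (recoverʳ X∈ Y∈ e)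

      ⊆D⇒≡ : ∀ {Z} → Z ⊆ D → Z ≡ (S ∩ Z) ∪ (T ∩ Z)
      ⊆D⇒≡ Z⊆D = ⊆∪⇒≡∩∪∩ (⊆-trans Z⊆D (p─q⊆p _ _))

      ∪S′≡ : ∀ {Z X Y} → Z ≡ X ∪ Y → Z ∪ S′ ≡ (X ∪ S₁) ∪ (Y ∪ T₁)
      ∪S′≡ {X = X} {Y} Z≡ = trans (cong (_∪ S′) Z≡) (∪-∪-∩ X Y S′⊆S∪T)

      ⊆D : ∀ {Z X Y} → Z ≡ X ∪ Y → X ⊆ᵇ (S ─ S₁) ≡ true → Y ⊆ᵇ (T ─ T₁) ≡ true → Z ⊆ᵇ D ≡ true
      ⊆D Z≡ X⊆ Y⊆ = ⊆ᵇ⁺ (subst (_⊆ D) (sym Z≡) (∪-⊆-─ (⊆ᵇ⁻ X⊆) (⊆ᵇ⁻ Y⊆)))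

      ∩-∈contractⁱ : ∀ {U} (K : Intervals) {Z Z′} → Z ⊆ Z′ → Z′ ⊆ D →
                     K ((U ∩ Z) ∪ (U ∩ S′)) ((U ∩ Z′) ∪ (U ∩ S′)) ≡ true →
                     contractⁱ U (U ∩ S′) K (U ∩ Z) (U ∩ Z′) ≡ true
      ∩-∈contractⁱ {U} K {Z} {Z′} Z⊆Z′ Z′⊆D ∈K =
        ∧-≡true⁺ (⊆ᵇ⁺ {X = U ∩ Z} (∩-monoʳ Z⊆Z′)) (∧-≡true⁺ (⊆ᵇ⁺ {X = U ∩ Z′} (∩-⊆-─ Z′⊆D)) ∈K)

    contract-⊗ᶠ : ∀ Z →
                  contractᶠ (S ∪ T) S′ (p ⊗ᶠ q) Z ≡ (contractᶠ S S₁ p ⊗ᶠ contractᶠ T T₁ q) Z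
    contract-⊗ᶠ Z = ≡true-ext
      (λ e → let Z⊆D , Z∪S′∈ = ∧-≡true⁻ (Z ⊆ᵇ D) e
                 split X Y X∈ Y∈ Z∪S′≡ = ⊗ᶠ⁻ p q Z∪S′∈ in
             ⊗ᶠ⁺ (contractᶠ S S₁ p) (contractᶠ T T₁ q) (split (S ∩ Z) (T ∩ Z)
               (∧-≡true⁺ (⊆ᵇ⁺ (∩-⊆-─ (⊆ᵇ⁻ Z⊆D))) (∈-resp p (sym (∪S₁≡ X∈ Y∈ Z∪S′≡)) X∈))
               (∧-≡true⁺ (⊆ᵇ⁺ (∩-⊆-─ (⊆ᵇ⁻ Z⊆D))) (∈-resp q (sym (∪T₁≡ X∈ Y∈ Z∪S′≡)) Y∈))
               (⊆D⇒≡ (⊆ᵇ⁻ Z⊆D))))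
      (λ e → let split X Y X∈′ Y∈′ Z≡ = ⊗ᶠ⁻ (contractᶠ S S₁ p) (contractᶠ T T₁ q) e
                 X⊆ , X∪S₁∈ = ∧-≡true⁻ (X ⊆ᵇ (S ─ S₁)) X∈′
                 Y⊆ , Y∪T₁∈ = ∧-≡true⁻ (Y ⊆ᵇ (T ─ T₁)) Y∈′ in
             ∧-≡true⁺ (⊆D Z≡ X⊆ Y⊆) (⊗ᶠ⁺ p q (split (X ∪ S₁) (Y ∪ T₁) X∪S₁∈ Y∪T₁∈ (∪S′≡ Z≡))))

    contract-⊗ⁱ : ∀ Z Z′ →
                  contractⁱ (S ∪ T) S′ (I ⊗ⁱ J) Z Z′ ≡ (contractⁱ S S₁ I ⊗ⁱ contractⁱ T T₁ J) Z Z′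
    contract-⊗ⁱ Z Z′ = ≡true-ext
      (λ e → let Z⊆Z′ , e′ = ∧-≡true⁻ (Z ⊆ᵇ Z′) e
                 Z′⊆D , e″ = ∧-≡true⁻ (Z′ ⊆ᵇ D) e′
                 isplit X X′ Y Y′ i j e₁ e₂ = ⊗ⁱ⁻ I J {Z ∪ S′} {Z′ ∪ S′} e″
                 Z⊆D = ⊆-trans (⊆ᵇ⁻ Z⊆Z′) (⊆ᵇ⁻ Z′⊆D) in
             ⊗ⁱ⁺ (contractⁱ S S₁ I) (contractⁱ T T₁ J) {Z} {Z′}
               (isplit (S ∩ Z) (S ∩ Z′) (T ∩ Z) (T ∩ Z′)
                 (∩-∈contractⁱ I (⊆ᵇ⁻ Z⊆Z′) (⊆ᵇ⁻ Z′⊆D)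
                   (∈ⁱ-resp I (sym (∪S₁≡ (A.lower∈ i) (B.lower∈ j) e₁))
                              (sym (∪S₁≡ (A.upper∈ i) (B.upper∈ j) e₂)) i))
                 (∩-∈contractⁱ J (⊆ᵇ⁻ Z⊆Z′) (⊆ᵇ⁻ Z′⊆D)
                   (∈ⁱ-resp J (sym (∪T₁≡ (A.lower∈ i) (B.lower∈ j) e₁))
                              (sym (∪T₁≡ (A.upper∈ i) (B.upper∈ j) e₂)) j))
                 (⊆D⇒≡ Z⊆D) (⊆D⇒≡ (⊆ᵇ⁻ Z′⊆D))))
      (λ e → let isplit X X′ Y Y′ i′ j′ e₁ e₂ = ⊗ⁱ⁻ (contractⁱ S S₁ I) (contractⁱ T T₁ J) {Z} {Z′} e
                 X⊆X′ , i″ = ∧-≡true⁻ (X ⊆ᵇ X′) i′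
                 X′⊆ , i = ∧-≡true⁻ (X′ ⊆ᵇ (S ─ S₁)) i″
                 Y⊆Y′ , j″ = ∧-≡true⁻ (Y ⊆ᵇ Y′) j′
                 Y′⊆ , j = ∧-≡true⁻ (Y′ ⊆ᵇ (T ─ T₁)) j″ in
             ∧-≡true⁺ (⊆ᵇ⁺ (subst₂ _⊆_ (sym e₁) (sym e₂) (∪-mono (⊆ᵇ⁻ X⊆X′) (⊆ᵇ⁻ Y⊆Y′))))
               (∧-≡true⁺ (⊆D e₂ X′⊆ Y′⊆)
                 (⊗ⁱ⁺ I J (isplit (X ∪ S₁) (X′ ∪ S₁) (Y ∪ T₁) (Y′ ∪ T₁) i j (∪S′≡ e₁) (∪S′≡ e₂)))))

    S′∉⊗ : p S₁ ≡ false ⊎ q T₁ ≡ false → (p ⊗ᶠ q) S′ ≡ false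
    S′∉⊗ (inj₁ S₁∉p) = ≡false-contra (λ e → proj₁ (S′∈⊗⁻ e)) S₁∉p
    S′∉⊗ (inj₂ T₁∉q) = ≡false-contra (λ e → proj₂ (S′∈⊗⁻ e)) T₁∉q

  ·C-𝟘ʳ : ∀ x → x ·C 𝟘 ≡ 𝟘
  ·C-𝟘ʳ 𝟘        = refl
  ·C-𝟘ʳ (cp _ _) = refl

  ·C-zero : ∀ {x y} → x ≡ 𝟘 ⊎ y ≡ 𝟘 → x ·C y ≡ 𝟘
  ·C-zero     (inj₁ refl) = refl
  ·C-zero {x} (inj₂ refl) = ·C-𝟘ʳ x

  restr-· : ∀ S T S′ x y → Disjoint S T → InC S x → InC T y → S′ ⊆ (S ∪ T) →
            restrC (S ∪ T) S′ (x ·C y) ≈C (restrC S (S ∩ S′) x ·C restrC T (T ∩ S′) y)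
  restr-· S T S′ 𝟘        y        _   _  _  _       = tt
  restr-· S T S′ (cp p I) 𝟘        _   _  _  _       = ≈C-resp-≡ refl (·C-𝟘ʳ _) tt
  restr-· S T S′ (cp p I) (cp q J) S#T cx cy S′⊆S∪T
    with both-true-or-one-false (p (S ∩ S′)) (q (T ∩ S′))
  ... | inj₂ one =
    ≈C-resp-≡ (restrC-∉ (S ∪ T) S′ (p ⊗ᶠ q) (I ⊗ⁱ J) (S′∉⊗ one))
              (·C-zero (Sum.map (restrC-∉ S (S ∩ S′) p I) (restrC-∉ T (T ∩ S′) q J) one)) tt
    where open ProductRestriction S#T cx cy S′⊆S∪T
  ... | inj₁ (S₁∈p , T₁∈q) =
    ≈C-resp-≡ (restrC-∈ (S ∪ T) S′ (p ⊗ᶠ q) (I ⊗ⁱ J) (S′∈⊗⁺ S₁∈p T₁∈q))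
              (cong₂ _·C_ (restrC-∈ S (S ∩ S′) p I S₁∈p) (restrC-∈ T (T ∩ S′) q J T₁∈q))
              (restrict-⊗ᶠ , restrict-⊗ⁱ)
    where open ProductRestriction S#T cx cy S′⊆S∪T

  contr-· : ∀ S T S′ x y → Disjoint S T → InC S x → InC T y → S′ ⊆ (S ∪ T) →
            contrC (S ∪ T) S′ (x ·C y) ≈C (contrC S (S ∩ S′) x ·C contrC T (T ∩ S′) y)
  contr-· S T S′ 𝟘        y        _   _  _  _       = tt
  contr-· S T S′ (cp p I) 𝟘        _   _  _  _       = ≈C-resp-≡ refl (·C-𝟘ʳ _) tt
  contr-· S T S′ (cp p I) (cp q J) S#T cx cy S′⊆S∪T
    with both-true-or-one-false (p (S ∩ S′)) (q (T ∩ S′))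
  ... | inj₂ one =
    ≈C-resp-≡ (contrC-∉ (S ∪ T) S′ (p ⊗ᶠ q) (I ⊗ⁱ J) (S′∉⊗ one))
              (·C-zero (Sum.map (contrC-∉ S (S ∩ S′) p I) (contrC-∉ T (T ∩ S′) q J) one)) tt
    where open ProductRestriction S#T cx cy S′⊆S∪T
  ... | inj₁ (S₁∈p , T₁∈q) =
    ≈C-resp-≡ (contrC-∈ (S ∪ T) S′ (p ⊗ᶠ q) (I ⊗ⁱ J) (S′∈⊗⁺ S₁∈p T₁∈q))
              (cong₂ _·C_ (contrC-∈ S (S ∩ S′) p I S₁∈p) (contrC-∈ T (T ∩ S′) q J T₁∈q))
              (contract-⊗ᶠ , contract-⊗ⁱ)
    where open ProductRestriction S#T cx cy S′⊆S∪T

  isBimonoid : IsBimonoid 𝐂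
  isBimonoid = record
    { isPointedSpecies = isPointedSpecies
    ; isMonoid         = isMonoid
    ; isComonoid       = isComonoid
    ; restr-·          = restr-·
    ; contr-·          = contr-·
    ; 𝟙≉𝟘              = λ ()
    }

  full⇒∈ : ∀ p {I} → IsFull p I → ∀ {X Y} → p X ≡ true → p Y ≡ true → X ⊆ Y → I X Y ≡ true
  full⇒∈ p full {X} {Y} X∈ Y∈ X⊆Y = trans (full X Y) (∧-≡true⁺ X∈ (∧-≡true⁺ Y∈ (⊆ᵇ⁺ X⊆Y)))

  -- Every coloring problem has I ⊆ Int(p), so only the converse inclusion needs checking.
  ∈⇒full : ∀ {N p I} → IsColoringProblem N p I →
           (∀ X Y → p X ≡ true → p Y ≡ true → X ⊆ Y → I X Y ≡ true) → IsFull p I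
  ∈⇒full {p = p} {I} c comparable⇒∈ X Y = ≡true-ext
    (λ e → ∧-≡true⁺ (lower∈ e) (∧-≡true⁺ (upper∈ e) (⊆ᵇ⁺ (lower⊆upper e))))
    (λ e → let X∈ , e′ = ∧-≡true⁻ (p X) e
               Y∈ , X⊆Y = ∧-≡true⁻ (p Y) e′ in
           comparable⇒∈ X Y X∈ Y∈ (⊆ᵇ⁻ X⊆Y))
    where open Problem c

  stable-relabel : ∀ π N x → InC N x → isStable x → isStable (relabelC π x)
  stable-relabel π N 𝟘        _ _    = tt
  stable-relabel π N (cp p I) c full = ∈⇒full (relabel-In π N (cp p I) c)
    (λ X Y X∈ Y∈ X⊆Y → full⇒∈ p full X∈ Y∈ (preimg-mono π X⊆Y))

  stable-· : ∀ M N x y → Disjoint M N → InC M x → InC N y →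
             isStable x → isStable y → isStable (x ·C y)
  stable-· M N 𝟘        y        _   _  _  _     _     = tt
  stable-· M N (cp p I) 𝟘        _   _  _  _     _     = tt
  stable-· M N (cp p I) (cp q J) M#N cx cy fullₓ fullᵧ =
    ∈⇒full (·-In M N (cp p I) (cp q J) M#N cx cy) comparable⇒∈
    where
    open DisjointProblems M#N cx cy
    comparable⇒∈ : ∀ Z Z′ → (p ⊗ᶠ q) Z ≡ true → (p ⊗ᶠ q) Z′ ≡ true → Z ⊆ Z′ →
                   (I ⊗ⁱ J) Z Z′ ≡ true
    comparable⇒∈ Z Z′ Z∈ Z′∈ Z⊆Z′ with ⊗ᶠ⁻ p q Z∈ | ⊗ᶠ⁻ p q Z′∈
    ... | split X Y X∈ Y∈ Z≡ | split X′ Y′ X′∈ Y′∈ Z′≡ =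
      let X⊆X′ , Y⊆Y′ = split-⊆ X∈ Y∈ X′∈ Y′∈ (subst₂ _⊆_ Z≡ Z′≡ Z⊆Z′) in
      ⊗ⁱ⁺ I J (isplit X X′ Y Y′ (full⇒∈ p fullₓ X∈ X′∈ X⊆X′) (full⇒∈ q fullᵧ Y∈ Y′∈ Y⊆Y′) Z≡ Z′≡)

  stable-restr : ∀ N S x → S ⊆ N → InC N x → isStable x → isStable (restrC N S x)
  stable-restr N S 𝟘        _   _ _    = tt
  stable-restr N S (cp p I) S⊆N c full with true-or-false (p S)
  ... | inj₂ S∉p = subst isStable (sym (restrC-∉ N S p I S∉p)) tt
  ... | inj₁ S∈p = subst isStable (sym (restrC-∈ N S p I S∈p))
    (∈⇒full (subst (InC S) (restrC-∈ N S p I S∈p) (restr-In N S (cp p I) S⊆N c))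
      (λ X Y X∈′ Y∈′ X⊆Y → let X∈ , _ = ∧-≡true⁻ (p X) X∈′
                               Y∈ , Y⊆S = ∧-≡true⁻ (p Y) Y∈′ in
                           ∧-≡true⁺ (full⇒∈ p full X∈ Y∈ X⊆Y) Y⊆S))

  stable-contr : ∀ N S x → S ⊆ N → InC N x → isStable x → isStable (contrC N S x)
  stable-contr N S 𝟘        _   _ _    = tt
  stable-contr N S (cp p I) S⊆N c full with true-or-false (p S)
  ... | inj₂ S∉p = subst isStable (sym (contrC-∉ N S p I S∉p)) tt
  ... | inj₁ S∈p = subst isStable (sym (contrC-∈ N S p I S∈p))
    (∈⇒full (subst (InC (N ─ S)) (contrC-∈ N S p I S∈p) (contr-In N S (cp p I) S⊆N c))
      (λ X Y X∈′ Y∈′ X⊆Y → let _ , X∪S∈ = ∧-≡true⁻ (X ⊆ᵇ (N ─ S)) X∈′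
                               Y⊆N─S , Y∪S∈ = ∧-≡true⁻ (Y ⊆ᵇ (N ─ S)) Y∈′ in
                           ∧-≡true⁺ (⊆ᵇ⁺ X⊆Y)
                             (∧-≡true⁺ Y⊆N─S (full⇒∈ p full X∪S∈ Y∪S∈ (∪-mono X⊆Y ⊆-refl)))))

  unstable-relabel : ∀ π N x → InC N x → isUnstable x → isUnstable (relabelC π x)
  unstable-relabel π N 𝟘        _ _        = tt
  unstable-relabel π N (cp p I) c unstable full′ = unstable (∈⇒full c λ X Y X∈ Y∈ X⊆Y →
    ∈ⁱ-resp I (preimg-img π X) (preimg-img π Y)
      (full⇒∈ (relabelᶠ π p) full′ (∈-resp p (sym (preimg-img π X)) X∈)
                                   (∈-resp p (sym (preimg-img π Y)) Y∈) (img-mono π X⊆Y)))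

  -- If x · y or y · x is stable then so is y: [Y, Y′] = [∅, ∅] · [Y, Y′], and products of
  -- intervals split uniquely.
  unstable-ideal : ∀ M N x y → Disjoint M N → InC M x → InC N y → isUnstable y →
                   isUnstable (x ·C y) × isUnstable (y ·C x)
  unstable-ideal M N 𝟘        y        _   _  _  _        = tt , ·C-𝟘ʳ-unstable y
    where
    ·C-𝟘ʳ-unstable : ∀ y → isUnstable (y ·C 𝟘)
    ·C-𝟘ʳ-unstable y = subst isUnstable (sym (·C-𝟘ʳ y)) tt
  unstable-ideal M N (cp p I) 𝟘        _   _  _  _        = tt , tt
  unstable-ideal M N (cp p I) (cp q J) M#N cx cy unstable =
    (λ full → unstable (∈⇒full cy (right-factor full))) ,
    (λ full → unstable (∈⇒full cy (left-factor full)))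
    where
    module A = Problem cx
    open DisjointProblems M#N cx cy using (split-≡)
    open DisjointProblems (trans (∩-comm N M) M#N) cy cx using () renaming (split-≡ to split-≡′)
    right-factor : IsFull (p ⊗ᶠ q) (I ⊗ⁱ J) →
                   ∀ Y Y′ → q Y ≡ true → q Y′ ≡ true → Y ⊆ Y′ → J Y Y′ ≡ true
    right-factor full Y Y′ Y∈ Y′∈ Y⊆Y′ =
      let isplit X X′ W W′ i j e₁ e₂ =
            ⊗ⁱ⁻ I J (full⇒∈ (p ⊗ᶠ q) full (⊗ᶠ⁺ p q (split ⊥ Y A.∅∈p Y∈ (sym (∪-identityˡ Y))))
                                 (⊗ᶠ⁺ p q (split ⊥ Y′ A.∅∈p Y′∈ (sym (∪-identityˡ Y′)))) Y⊆Y′)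
          _ , Y≡W   = split-≡ A.∅∈p Y∈ (A.lower∈ i) (lower∈ j) (trans (∪-identityˡ Y) e₁)
          _ , Y′≡W′ = split-≡ A.∅∈p Y′∈ (A.upper∈ i) (upper∈ j) (trans (∪-identityˡ Y′) e₂)
      in ∈ⁱ-resp J (sym Y≡W) (sym Y′≡W′) j
      where open Problem cy
    left-factor : IsFull (q ⊗ᶠ p) (J ⊗ⁱ I) →
                  ∀ Y Y′ → q Y ≡ true → q Y′ ≡ true → Y ⊆ Y′ → J Y Y′ ≡ true
    left-factor full Y Y′ Y∈ Y′∈ Y⊆Y′ =
      let isplit W W′ X X′ j i e₁ e₂ =
            ⊗ⁱ⁻ J I (full⇒∈ (q ⊗ᶠ p) full (⊗ᶠ⁺ q p (split Y ⊥ Y∈ A.∅∈p (sym (∪-identityʳ Y))))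
                                 (⊗ᶠ⁺ q p (split Y′ ⊥ Y′∈ A.∅∈p (sym (∪-identityʳ Y′)))) Y⊆Y′)
          Y≡W , _   = split-≡′ Y∈ A.∅∈p (lower∈ j) (A.lower∈ i) (trans (∪-identityʳ Y) e₁)
          Y′≡W′ , _ = split-≡′ Y′∈ A.∅∈p (upper∈ j) (A.upper∈ i) (trans (∪-identityʳ Y′) e₂)
      in ∈ⁱ-resp J (sym Y≡W) (sym Y′≡W′) j
      where open Problem cy

  stable-or-unstable : ∀ N x → InC N x → isStable x ⊎ isUnstable x
  stable-or-unstable N 𝟘        _ = inj₁ tt
  stable-or-unstable N (cp p I) _ with allSubsets? (λ X → allSubsets? (λ Y → I X Y Bool.≟ Int p X Y))
  ... | yes full    = inj₁ full
  ... | no not-full = inj₂ not-full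

  stable∧unstable⇒𝟘 : ∀ N x → InC N x → isStable x → isUnstable x → x ≈C 𝟘
  stable∧unstable⇒𝟘 N 𝟘        _ _    _        = tt
  stable∧unstable⇒𝟘 N (cp p I) _ full unstable = contradiction full unstable

mainTheorem8 : (k : ℕ) →
    IsCombinatorialHopfMonoid (Coloring.𝐂 k) (Coloring.isStable k) (Coloring.isUnstable k)
mainTheorem8 k = record
  { isBimonoid              = isBimonoid
  ; isCombinatorialComonoid = combinatorial
  ; 𝐒-hopfSubmonoid         = record
    { isSubspecies = record { G-𝟘 = tt ; G-relabel = stable-relabel }
    ; G-·          = stable-·
    ; G-restr      = stable-restr
    ; G-contr      = stable-contr
    }
  ; 𝐈-ideal                 = record
    { isSubspecies = record { G-𝟘 = tt ; G-relabel = unstable-relabel }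
    ; G-ideal      = unstable-ideal
    }
  ; cover                   = stable-or-unstable
  ; disjoint                = stable∧unstable⇒𝟘
  }
  where open ColoringProblems k
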